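{- Let $\beta\subseteq\alpha$ be compositions such that $\beta$ is a partition (its parts are weakly decreasing) and the skew diagram $\alpha/\beta$ is reduced. Then the poset $\mathrm{SET}(\alpha/\beta)$ has a unique minimal element, $S^{\mathrm{col}}_{\alpha/\beta}$. Equivalently, $\mathrm{SET}(\alpha/\beta)$ coincides with the interval $[S^{\mathrm{col}}_{\alpha/\beta},S^{\mathrm{row}}_{\alpha/\beta}]$ of the poset $\mathrm{SIT}(\alpha/\beta)$, and its rank (the length of a longest chain) is $\binom{|\alpha/\beta|}{2}-\sum_{c\in\alpha/\beta}\mathrm{ls}(c)$.
   Context: A composition is a finite sequence $\alpha=(\alpha_1,\ldots,\alpha_k)$ of positive integers; $|\alpha|=\sum_i\alpha_i$. Its diagram has $\alpha_i$ left-justified cells in row $i$, rows numbered from the bottom (row 1 lowest). For compositions $\beta\subseteq\alpha$ (meaning $\ell(\beta)\le\ell(\alpha)$ and $\beta_j\le\alpha_j$ for $j\le\ell(\beta)$), the skew diagram $\alpha/\beta$ is the set of cells of the diagram of $\alpha$ not in that of $\beta$ (same bottom-left corner); $n=|\alpha/\beta|=|\alpha|-|\beta|$. $\alpha/\beta$ is reduced if it has no empty rows, i.e. no row $i$ with $\alpha_i=\beta_i$. A standard immaculate tableau of shape $\alpha/\beta$ is a bijective filling of the cells with $1,\ldots,n$ such that each row strictly increases left to right and the entries in the cells of $\alpha/\beta$ lying in the first column strictly increase bottom to top; $\mathrm{SIT}(\alpha/\beta)$ is the set of these. A standard extended tableau additionally has all columns strictly increasing bottom to top; $\mathrm{SET}(\alpha/\beta)\subseteq\mathrm{SIT}(\alpha/\beta)$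 is the set of these. For $1\le i\le n-1$ and a tableau $T$, $\pi_i(T)=T$ if $i+1$ is in a strictly higher row than $i$; $\pi_i(T)=s_i(T)$ (swap entries $i$ and $i+1$) if $i+1$ is in a strictly lower row than $i$; $\pi_i(T)=0$ if $i,i+1$ are in the same row. Partial order on $\mathrm{SIT}(\alpha/\beta)$ (and on the subset $\mathrm{SET}(\alpha/\beta)$): $S\le T$ iff $T$ is obtained from $S$ by applying a finite sequence of operators $\pi_i$ with all intermediate results nonzero. $S^{\mathrm{row}}_{\alpha/\beta}$ is filled with $1,\ldots,n$ consecutively along rows left to right, starting with the bottom row and moving up; $S^{\mathrm{col}}_{\alpha/\beta}$ is filled with $1,\ldots,n$ consecutively along columns bottom to top, starting with the leftmost column and moving right. For a cell $c$, $\mathrm{ls}(c)$ is the number of cells of $\alpha/\beta$ weakly southwest of $c$, excluding $c$ itself. -}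

module Defs where

open import Data.Bool using (Bool; true; false; if_then_else_; _∧_)
open import Data.Nat using (ℕ; zero; suc; _+_; _∸_; _≤_; _<_; _≥_; _<ᵇ_; _≤ᵇ_; _≡ᵇ_)
open import Data.Nat.Combinatorics using (_C_)
open import Data.List using (List; []; _∷_; length; map; upTo; concat; filterᵇ)
open import Data.Nat.ListAction using (sum)
open import Data.Bool.ListAction using (any)
open import Data.List.Relation.Unary.All using (All)
open import Data.List.Relation.Unary.Linked using (Linked)
open import Data.List.Relation.Binary.Permutation.Propositional using (_↭_)
open import Data.Maybe using (Maybe; just; nothing)
open import Data.Product using (_×_; ∃)
open import Relation.Binary.PropositionalEquality using (_≡_; _≢_)
open import Relation.Binary.Construct.Closure.ReflexiveTransitive using (Star)

-- Compositions. A composition is a list of positive naturals; list index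
-- 0 is row 1 (the bottom row).  Rows/columns are 0-indexed internally.

IsComposition : List ℕ → Set
IsComposition α = All (λ x → 1 ≤ x) α

IsPartition : List ℕ → Set
IsPartition β = Linked _≥_ β

part : List ℕ → ℕ → ℕ
part []       _       = 0
part (x ∷ xs) zero    = x
part (x ∷ xs) (suc i) = part xs i

data _⊆c_ : List ℕ → List ℕ → Set where
  []⊆  : ∀ {α} → [] ⊆c α
  _∷⊆_ : ∀ {b a β α} → b ≤ a → β ⊆c α → (b ∷ β) ⊆c (a ∷ α)

Reduced : List ℕ → List ℕ → Set
Reduced α β = ∀ i → i < length α → part α i ≢ part β i

size : List ℕ → List ℕ → ℕ
size α β = sum α ∸ sum β

InShape : List ℕ → List ℕ → ℕ → ℕ → Set
InShape α β r c = r < length α × part β r ≤ c × c < part α r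

inShapeᵇ : List ℕ → List ℕ → ℕ → ℕ → Bool
inShapeᵇ α β r c = (r <ᵇ length α) ∧ ((part β r ≤ᵇ c) ∧ (c <ᵇ part α r))

count : (ℕ → Bool) → List ℕ → ℕ
count p xs = length (filterᵇ p xs)

-- Tableaux: a list of rows (bottom row first); row r lists the entries of
-- the cells (r , part β r), (r , part β r + 1), ..., (r , part α r - 1).

Tab : Set
Tab = List (List ℕ)

rowD : Tab → ℕ → List ℕ
rowD []       _       = []
rowD (x ∷ xs) zero    = x
rowD (x ∷ xs) (suc i) = rowD xs i

lookupD : List ℕ → ℕ → ℕ
lookupD []       _       = 0
lookupD (x ∷ xs) zero    = x
lookupD (x ∷ xs) (suc i) = lookupD xs i

entry : List ℕ → Tab → ℕ → ℕ → ℕ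
entry β T r c = lookupD (rowD T r) (c ∸ part β r)

HasShape : List ℕ → List ℕ → Tab → Set
HasShape α β T = length T ≡ length α
               × (∀ r → r < length α → length (rowD T r) ≡ part α r ∸ part β r)

IsSIT : List ℕ → List ℕ → Tab → Set
IsSIT α β T =
    HasShape α β T
  × (concat T ↭ map suc (upTo (size α β)))
  × All (Linked _<_) T
  × (∀ r r' → r < r' → InShape α β r 0 → InShape α β r' 0
            → entry β T r 0 < entry β T r' 0)

IsSET : List ℕ → List ℕ → Tab → Set
IsSET α β T = IsSIT α β T
  × (∀ c r r' → r < r' → InShape α β r c → InShape α β r' c
              → entry β T r c < entry β T r' c)

rowOf : ℕ → Tab → ℕ
rowOf k []      = 0
rowOf k (ρ ∷ T) = if any (k ≡ᵇ_) ρ then 0 else suc (rowOf k T)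

swapT : ℕ → Tab → Tab
swapT i = map (map (λ x → if x ≡ᵇ i then suc i else (if x ≡ᵇ suc i then i else x)))

-- π_i T ; nothing represents 0
π : ℕ → Tab → Maybe Tab
π i T = if rowOf i T <ᵇ rowOf (suc i) T then just T
        else (if rowOf (suc i) T <ᵇ rowOf i T then just (swapT i T) else nothing)

Step : ℕ → Tab → Tab → Set
Step n S T = ∃ λ i → 1 ≤ i × suc i ≤ n × π i S ≡ just T

Leq : List ℕ → List ℕ → Tab → Tab → Set
Leq α β = Star (Step (size α β))

rowLens : List ℕ → List ℕ → List ℕ
rowLens α β = map (λ r → part α r ∸ part β r) (upTo (length α))

rowsFrom : ℕ → List ℕ → Tab
rowsFrom s []      = []
rowsFrom s (l ∷ ls) = map (λ k → s + suc k) (upTo l) ∷ rowsFrom (s + l) ls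

Srow : List ℕ → List ℕ → Tab
Srow α β = rowsFrom 0 (rowLens α β)

colsOf : List ℕ → List ℕ → ℕ → List ℕ
colsOf α β r = map (part β r +_) (upTo (part α r ∸ part β r))

colCount : List ℕ → List ℕ → ℕ → ℕ
colCount α β c = count (λ r → inShapeᵇ α β r c) (upTo (length α))

colIndex : List ℕ → List ℕ → ℕ → ℕ → ℕ
colIndex α β r c = sum (map (colCount α β) (upTo c))
                 + count (λ r' → inShapeᵇ α β r' c) (upTo r) + 1

Scol : List ℕ → List ℕ → Tab
Scol α β = map (λ r → map (colIndex α β r) (colsOf α β r)) (upTo (length α))

ls : List ℕ → List ℕ → ℕ → ℕ → ℕ
ls α β r c = sum (map (λ r' → count (λ c' → inShapeᵇ α β r' c') (upTo (suc c)))
                      (upTo (suc r))) ∸ 1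

totalLs : List ℕ → List ℕ → ℕ
totalLs α β = sum (map (λ r → sum (map (ls α β r) (colsOf α β r))) (upTo (length α)))

IsMinimalSET : List ℕ → List ℕ → Tab → Set
IsMinimalSET α β M = IsSET α β M × (∀ T → IsSET α β T → Leq α β T M → T ≡ M)

-- a chain T₀ < T₁ < ... < T_k in SET(α/β); its length is k
IsChain : List ℕ → List ℕ → List Tab → Set
IsChain α β Ts = 1 ≤ length Ts × All (IsSET α β) Ts
               × Linked (λ S T → Leq α β S T × S ≢ T) Ts

HasRank : List ℕ → List ℕ → ℕ → Set
HasRank α β k = (∃ λ Ts → IsChain α β Ts × length Ts ≡ suc k)
              × (∀ Ts → IsChain α β Ts → length Ts ≤ suc k)

-- The number of inversions of the row word k ↦ (row of k) is a strict rank function for the order: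
-- a nonzero π_i either fixes T or swaps i and i+1 when i+1 lies in a lower row, which removes
-- exactly one inversion.  Bubble-sorting the row word therefore leads from any standard filling
-- to S^row in steps that each remove one inversion.  If a standard extended tableau is not
-- S^col, then some i+1 lies strictly north-west of i (this uses that β is a partition), and
-- swapping them yields a standard extended tableau one π-step below it; so S^col lies below
-- every SET.  Finally, a pair of cells read x before y in the column reading is an inversion of
-- S^col exactly when x is not weakly south-west of y, whence inv(S^col) = C(n,2) − Σ ls(c); the
-- bubble-sort chain from S^col has this length and no chain is longer.

module Submission where

open import Defs
open import Data.List using (List)
open import Data.Nat using (ℕ; _∸_)
open import Data.Nat.Combinatorics using (_C_)
open import Data.Product using (_×_)
open import Function.Bundles using (_⇔_)
open import Relation.Binary.PropositionalEquality using (_≡_)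

open import Data.Bool using (Bool; true; false; if_then_else_; _∧_; _∨_; not)
open import Data.Bool.ListAction using (any)
open import Data.Bool.Properties using (∧-assoc; ∧-identityʳ; ∧-zeroʳ)
open import Data.Empty using (⊥-elim)
open import Data.List using ([]; _∷_; _++_; _∷ʳ_; map; upTo; applyUpTo; concat; length)
open import Data.List.Membership.Propositional using (_∈_; _∉_; find; lose)
open import Data.List.Membership.Propositional.Properties
  using (∈-++⁺ˡ; ∈-++⁺ʳ; ∈-++⁻; ∈-map⁺; ∈-map⁻; ∈-∃++; ∈-upTo⁺; ∈-upTo⁻; ∈-concat⁺′; ∈-concat⁻′)
open import Data.List.Properties
  using (map-++; map-∘; map-cong; map-cong-local; map-id; concat-map; length-map; map-applyUpTo; length-applyUpTo; upTo-∷ʳ)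
open import Data.List.Relation.Binary.Permutation.Propositional using (_↭_; ↭-refl; ↭-sym; ↭-trans; ↭-prep; ↭⇒↭ₛ)
import Data.List.Relation.Binary.Permutation.Propositional.Properties as ↭
import Data.List.Relation.Binary.Permutation.Setoid.Properties as ↭ₛ
open import Data.List.Relation.Unary.All using (All; []; _∷_)
import Data.List.Relation.Unary.All as All
open import Data.List.Relation.Unary.AllPairs as AllPairs using ([]; _∷_)
open import Data.List.Relation.Unary.Any using (Any; here; there; any?)
open import Data.List.Relation.Unary.Linked using (Linked; []; [-]; _∷_)
import Data.List.Relation.Unary.Linked as Linked
open import Data.List.Relation.Unary.Linked.Properties using (Linked⇒All; applyUpTo⁺₁; applyUpTo⁺₂)
open import Data.List.Relation.Unary.Unique.Propositional using (Unique)
import Data.List.Relation.Unary.Unique.Propositional.Properties as Unique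
open import Data.Maybe using (just)
open import Data.Maybe.Properties using (just-injective)
open import Data.Nat using (zero; suc; pred; _+_; _*_; _≤_; _<_; _⊓_; z≤n; s≤s; z<s; _<ᵇ_; _≤ᵇ_; _≡ᵇ_)
open import Data.Nat.ListAction using (sum)
open import Data.Nat.ListAction.Properties using (sum-++; sum-↭)
open import Data.Nat.Properties
open import Algebra.Properties.CommutativeSemigroup +-commutativeSemigroup
  using () renaming (interchange to +-interchange; xy∙z≈xz∙y to +-right-comm)
open import Data.List.Membership.DecPropositional _≟_ using (_∈?_)
open import Data.Nat.Combinatorics using (nC1≡n; nCk+nC[k+1]≡[n+1]C[k+1])
open import Data.Product using (_,_; proj₁; proj₂; ∃)
open import Data.Product.Properties using (≡-dec)
open import Data.Sum using (_⊎_; inj₁; inj₂)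
open import Function using (_∘_; id)
open import Function.Bundles using (Equivalence; mk⇔)
open import Relation.Binary.Construct.Closure.ReflexiveTransitive using (ε; _◅_; _◅◅_)
open import Relation.Binary.Definitions using (tri<; tri≈; tri>)
open import Relation.Binary.PropositionalEquality using (_≢_; refl; sym; trans; cong; cong₂; subst; subst₂; setoid; module ≡-Reasoning)
open import Relation.Nullary using (¬_; Dec; yes; no; contradiction)
open import Relation.Nullary.Decidable using (dec-true; dec-false; _×-dec_; _⊎-dec_)

-- Indicators and finite sums

<ᵇ-true : ∀ {m n} → m < n → (m <ᵇ n) ≡ true
<ᵇ-true {m} {n} = dec-true (m <? n)

<ᵇ-false : ∀ {m n} → ¬ m < n → (m <ᵇ n) ≡ false
<ᵇ-false {m} {n} = dec-false (m <? n)

≤ᵇ-true : ∀ {m n} → m ≤ n → (m ≤ᵇ n) ≡ true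
≤ᵇ-true {m} {n} = dec-true (m ≤? n)

≤ᵇ-false : ∀ {m n} → ¬ m ≤ n → (m ≤ᵇ n) ≡ false
≤ᵇ-false {m} {n} = dec-false (m ≤? n)

≡ᵇ-true : ∀ {m n} → m ≡ n → (m ≡ᵇ n) ≡ true
≡ᵇ-true {m} {n} = dec-true (m ≟ n)

≡ᵇ-false : ∀ {m n} → m ≢ n → (m ≡ᵇ n) ≡ false
≡ᵇ-false {m} {n} = dec-false (m ≟ n)

≤ᵇ-<ᵇ : ∀ m n → (m ≤ᵇ n) ≡ (m <ᵇ suc n)
≤ᵇ-<ᵇ zero    n = refl
≤ᵇ-<ᵇ (suc m) n = refl

𝟙 : Bool → ℕ
𝟙 true  = 1
𝟙 false = 0

𝟙≤1 : ∀ b → 𝟙 b ≤ 1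
𝟙≤1 true  = ≤-refl
𝟙≤1 false = z≤n

𝟙-∧ : ∀ a b → 𝟙 (a ∧ b) ≡ (if b then 𝟙 a else 0)
𝟙-∧ a true  = cong 𝟙 (∧-identityʳ a)
𝟙-∧ a false = cong 𝟙 (∧-zeroʳ a)

𝟙-split : ∀ a b → 𝟙 a ≡ 𝟙 (a ∧ b) + 𝟙 (a ∧ not b)
𝟙-split true  true  = refl
𝟙-split true  false = refl
𝟙-split false _     = refl

𝟙-mono : ∀ {a b} → (a ≡ true → b ≡ true) → 𝟙 a ≤ 𝟙 b
𝟙-mono {false} _ = z≤n
𝟙-mono {true}  h rewrite h refl = ≤-refl

∑ : (ℕ → ℕ) → ℕ → ℕ
∑ f zero    = 0
∑ f (suc n) = ∑ f n + f n

sum-map-upTo : ∀ f n → sum (map f (upTo n)) ≡ ∑ f n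
sum-map-upTo f zero    = refl
sum-map-upTo f (suc n) = begin
  sum (map f (upTo (suc n)))          ≡⟨ cong (sum ∘ map f) (sym (upTo-∷ʳ n)) ⟩
  sum (map f (upTo n ∷ʳ n))           ≡⟨ cong sum (map-++ f (upTo n) (n ∷ [])) ⟩
  sum (map f (upTo n) ++ (f n ∷ []))  ≡⟨ sum-++ (map f (upTo n)) (f n ∷ []) ⟩
  sum (map f (upTo n)) + (f n + 0)    ≡⟨ cong₂ _+_ (sum-map-upTo f n) (+-identityʳ (f n)) ⟩
  ∑ f n + f n                         ∎
  where open ≡-Reasoning

∑-cong : ∀ {f g} n → (∀ x → x < n → f x ≡ g x) → ∑ f n ≡ ∑ g n
∑-cong zero    h = refl
∑-cong (suc n) h = cong₂ _+_ (∑-cong n (λ x x<n → h x (m<n⇒m<1+n x<n))) (h n ≤-refl)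

∑-mono-≤ : ∀ {f g} n → (∀ x → x < n → f x ≤ g x) → ∑ f n ≤ ∑ g n
∑-mono-≤ zero    h = z≤n
∑-mono-≤ (suc n) h = +-mono-≤ (∑-mono-≤ n (λ x x<n → h x (m<n⇒m<1+n x<n))) (h n ≤-refl)

∑-distrib-+ : ∀ f g n → ∑ (λ x → f x + g x) n ≡ ∑ f n + ∑ g n
∑-distrib-+ f g zero    = refl
∑-distrib-+ f g (suc n) =
  trans (cong (_+ (f n + g n)) (∑-distrib-+ f g n)) (+-interchange (∑ f n) (∑ g n) (f n) (g n))

∑-zero : ∀ {f} n → (∀ x → x < n → f x ≡ 0) → ∑ f n ≡ 0
∑-zero zero    h = refl
∑-zero (suc n) h = cong₂ _+_ (∑-zero n (λ x x<n → h x (m<n⇒m<1+n x<n))) (h n ≤-refl)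

∑-const : ∀ c n → ∑ (λ _ → c) n ≡ n * c
∑-const c zero    = refl
∑-const c (suc n) = trans (cong (_+ c) (∑-const c n)) (+-comm (n * c) c)

∑-split : ∀ f a b → ∑ f (a + b) ≡ ∑ f a + ∑ (λ x → f (a + x)) b
∑-split f a zero    = trans (cong (∑ f) (+-identityʳ a)) (sym (+-identityʳ _))
∑-split f a (suc b) = begin
  ∑ f (a + suc b)                                ≡⟨ cong (∑ f) (+-suc a b) ⟩
  ∑ f (a + b) + f (a + b)                        ≡⟨ cong (_+ f (a + b)) (∑-split f a b) ⟩
  ∑ f a + ∑ (λ x → f (a + x)) b + f (a + b)      ≡⟨ +-assoc (∑ f a) _ _ ⟩
  ∑ f a + (∑ (λ x → f (a + x)) b + f (a + b))    ∎
  where open ≡-Reasoning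

∑-suc : ∀ f n → ∑ f (suc n) ≡ f 0 + ∑ (f ∘ suc) n
∑-suc f n = trans (∑-split f 1 n) (cong (_+ ∑ (f ∘ suc) n) (+-identityˡ (f 0)))

∑-comm : ∀ (h : ℕ → ℕ → ℕ) n m → ∑ (λ x → ∑ (h x) m) n ≡ ∑ (λ y → ∑ (λ x → h x y) n) m
∑-comm h zero    m = sym (∑-zero m (λ _ _ → refl))
∑-comm h (suc n) m = begin
  ∑ (λ x → ∑ (h x) m) n + ∑ (h n) m              ≡⟨ cong (_+ ∑ (h n) m) (∑-comm h n m) ⟩
  ∑ (λ y → ∑ (λ x → h x y) n) m + ∑ (h n) m      ≡⟨ sym (∑-distrib-+ (λ y → ∑ (λ x → h x y) n) (h n) m) ⟩
  ∑ (λ y → ∑ (λ x → h x y) n + h n y) m          ∎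
  where open ≡-Reasoning

∑-mono-bound : ∀ f {a b} → a ≤ b → ∑ f a ≤ ∑ f b
∑-mono-bound f {a} {b} a≤b = begin
  ∑ f a                                  ≤⟨ m≤m+n (∑ f a) _ ⟩
  ∑ f a + ∑ (λ x → f (a + x)) (b ∸ a)    ≡⟨ sym (∑-split f a (b ∸ a)) ⟩
  ∑ f (a + (b ∸ a))                      ≡⟨ cong (∑ f) (m+[n∸m]≡n a≤b) ⟩
  ∑ f b                                  ∎
  where open ≤-Reasoning

∑𝟙≤ : ∀ (p : ℕ → Bool) n → ∑ (𝟙 ∘ p) n ≤ n
∑𝟙≤ p zero    = z≤n
∑𝟙≤ p (suc n) = subst (∑ (𝟙 ∘ p) (suc n) ≤_) (+-comm n 1) (+-mono-≤ (∑𝟙≤ p n) (𝟙≤1 (p n)))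

∑-restrict : ∀ (g : ℕ → ℕ) r l → r ≤ l → ∑ (λ x → if x <ᵇ r then g x else 0) l ≡ ∑ g r
∑-restrict g r l r≤l = begin
  ∑ g' l                                  ≡⟨ cong (∑ g') (sym (m+[n∸m]≡n r≤l)) ⟩
  ∑ g' (r + (l ∸ r))                      ≡⟨ ∑-split g' r (l ∸ r) ⟩
  ∑ g' r + ∑ (λ x → g' (r + x)) (l ∸ r)   ≡⟨ cong₂ _+_ (∑-cong r below) (∑-zero (l ∸ r) above) ⟩
  ∑ g r + 0                               ≡⟨ +-identityʳ _ ⟩
  ∑ g r                                   ∎
  where
  open ≡-Reasoning
  g' : ℕ → ℕ
  g' x = if x <ᵇ r then g x else 0
  below : ∀ x → x < r → g' x ≡ g x
  below x x<r rewrite <ᵇ-true x<r = refl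
  above : ∀ x → x < l ∸ r → g' (r + x) ≡ 0
  above x _ rewrite <ᵇ-false (m+n≮m r x) = refl

∑-point : ∀ p n d → p < n → ∑ (λ a → 𝟙 ((a ≡ᵇ p) ∧ d)) n ≡ 𝟙 d
∑-point p (suc n) d p<1+n with p ≟ n
... | yes refl rewrite ≡ᵇ-true (refl {x = p}) =
  cong (_+ 𝟙 d) (∑-zero p (λ a a<p → cong (λ b → 𝟙 (b ∧ d)) (≡ᵇ-false (<⇒≢ a<p))))
... | no p≢n rewrite ≡ᵇ-false {n} {p} (p≢n ∘ sym) =
  trans (+-identityʳ _) (∑-point p n d (≤∧≢⇒< (≤-pred p<1+n) p≢n))

∑ₗ : ∀ {A : Set} → (A → ℕ) → List A → ℕ
∑ₗ f xs = sum (map f xs)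

∑ₗ-++ : ∀ {A : Set} (f : A → ℕ) xs ys → ∑ₗ f (xs ++ ys) ≡ ∑ₗ f xs + ∑ₗ f ys
∑ₗ-++ f xs ys = trans (cong sum (map-++ f xs ys)) (sum-++ (map f xs) (map f ys))

∑ₗ-concat : ∀ {A : Set} (f : A → ℕ) xss → ∑ₗ f (concat xss) ≡ ∑ₗ (∑ₗ f) xss
∑ₗ-concat f []         = refl
∑ₗ-concat f (xs ∷ xss) = trans (∑ₗ-++ f xs (concat xss)) (cong (∑ₗ f xs +_) (∑ₗ-concat f xss))

∑ₗ-map : ∀ {A B : Set} (f : B → ℕ) (g : A → B) xs → ∑ₗ f (map g xs) ≡ ∑ₗ (f ∘ g) xs
∑ₗ-map f g []       = refl
∑ₗ-map f g (x ∷ xs) = cong (f (g x) +_) (∑ₗ-map f g xs)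

∑ₗ-↭ : ∀ {A : Set} (f : A → ℕ) {xs ys} → xs ↭ ys → ∑ₗ f xs ≡ ∑ₗ f ys
∑ₗ-↭ f p = sum-↭ (↭.map⁺ f p)

∑ₗ-cong : ∀ {A : Set} {f g : A → ℕ} xs → (∀ x → x ∈ xs → f x ≡ g x) → ∑ₗ f xs ≡ ∑ₗ g xs
∑ₗ-cong []       h = refl
∑ₗ-cong (x ∷ xs) h = cong₂ _+_ (h x (here refl)) (∑ₗ-cong xs (λ y y∈ → h y (there y∈)))

∑ₗ-zero : ∀ {A : Set} (f : A → ℕ) xs → (∀ x → x ∈ xs → f x ≡ 0) → ∑ₗ f xs ≡ 0
∑ₗ-zero f xs h = trans (∑ₗ-cong {g = λ _ → 0} xs h) (zeros xs)
  where
  zeros : ∀ {A : Set} (xs : List A) → ∑ₗ (λ _ → 0) xs ≡ 0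
  zeros []       = refl
  zeros (_ ∷ xs) = zeros xs

∑ₗ-mono-≤ : ∀ {A : Set} {f g : A → ℕ} xs → (∀ x → x ∈ xs → f x ≤ g x) → ∑ₗ f xs ≤ ∑ₗ g xs
∑ₗ-mono-≤ []       h = z≤n
∑ₗ-mono-≤ (x ∷ xs) h = +-mono-≤ (h x (here refl)) (∑ₗ-mono-≤ xs (λ y y∈ → h y (there y∈)))

∑ₗ-mono-< : ∀ {A : Set} {f g : A → ℕ} xs → (∀ z → z ∈ xs → f z ≤ g z) →
            ∀ {x} → x ∈ xs → f x < g x → ∑ₗ f xs < ∑ₗ g xs
∑ₗ-mono-< (z ∷ zs) h (here refl) lt = +-mono-<-≤ lt (∑ₗ-mono-≤ zs (λ w w∈ → h w (there w∈)))
∑ₗ-mono-< (z ∷ zs) h (there x∈) lt =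
  +-mono-≤-< (h z (here refl)) (∑ₗ-mono-< zs (λ w w∈ → h w (there w∈)) x∈ lt)

∑ₗ-distrib-+ : ∀ {A : Set} (f g : A → ℕ) xs → ∑ₗ (λ x → f x + g x) xs ≡ ∑ₗ f xs + ∑ₗ g xs
∑ₗ-distrib-+ f g []       = refl
∑ₗ-distrib-+ f g (x ∷ xs) =
  trans (cong (f x + g x +_) (∑ₗ-distrib-+ f g xs)) (+-interchange (f x) (g x) (∑ₗ f xs) (∑ₗ g xs))

∑ₗ𝟙<length : ∀ {A : Set} (p : A → Bool) xs → ∀ {x} → x ∈ xs → p x ≡ false → ∑ₗ (𝟙 ∘ p) xs < length xs
∑ₗ𝟙<length p (y ∷ ys) (here refl) e rewrite e = s≤s (≤length ys)
  where
  ≤length : ∀ ys → ∑ₗ (𝟙 ∘ p) ys ≤ length ys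
  ≤length []       = z≤n
  ≤length (y ∷ ys) = +-mono-≤ (𝟙≤1 (p y)) (≤length ys)
∑ₗ𝟙<length p (y ∷ ys) (there x∈) e =
  subst (_≤ suc (length ys)) (+-suc (𝟙 (p y)) _) (+-mono-≤ (𝟙≤1 (p y)) (∑ₗ𝟙<length p ys x∈ e))

-- Lists

module _ {A : Set} where

  private
    ∈-remove : ∀ {z x : A} {as bs} → z ∈ as ++ x ∷ bs → z ≢ x → z ∈ as ++ bs
    ∈-remove {as = as} z∈ z≢x with ∈-++⁻ as z∈
    ... | inj₁ p         = ∈-++⁺ˡ p
    ... | inj₂ (here e)  = ⊥-elim (z≢x e)
    ... | inj₂ (there p) = ∈-++⁺ʳ as p

    head-∉ : ∀ {x : A} {xs z} → Unique (x ∷ xs) → z ∈ xs → z ≢ x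
    head-∉ (x∉ ∷ _) z∈ z≡x = All.lookup x∉ z∈ (sym z≡x)

  Unique-↭ : ∀ {xs ys : List A} → xs ↭ ys → Unique xs → Unique ys
  Unique-↭ p = ↭ₛ.Unique-resp-↭ (setoid A) (↭⇒↭ₛ p)

  Unique-⊆⇒length≤ : ∀ {xs ys : List A} → Unique xs → (∀ x → x ∈ xs → x ∈ ys) → length xs ≤ length ys
  Unique-⊆⇒length≤ {[]}     _ _ = z≤n
  Unique-⊆⇒length≤ {x ∷ xs} u ⊆ys with ∈-∃++ (⊆ys x (here refl))
  ... | as , bs , refl =
    subst (suc (length xs) ≤_) (sym (↭.↭-length (↭.shift x as bs)))
      (s≤s (Unique-⊆⇒length≤ (AllPairs.tail u) (λ z z∈ → ∈-remove (⊆ys z (there z∈)) (head-∉ u z∈))))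

  Unique-⊆-⊇⇒↭ : ∀ {xs ys : List A} → Unique xs → Unique ys →
                 (∀ x → x ∈ xs → x ∈ ys) → (∀ x → x ∈ ys → x ∈ xs) → xs ↭ ys
  Unique-⊆-⊇⇒↭ {[]}     {[]}    _ _ _ _ = ↭-refl
  Unique-⊆-⊇⇒↭ {[]}     {y ∷ _} _ _ _ ⊇ with ⊇ y (here refl)
  ... | ()
  Unique-⊆-⊇⇒↭ {x ∷ xs} ux uy ⊆ ⊇ with ∈-∃++ (⊆ x (here refl))
  ... | as , bs , refl = ↭-trans (↭-prep x xs↭) (↭-sym x∷as++bs)
    where
    x∷as++bs : as ++ x ∷ bs ↭ x ∷ as ++ bs
    x∷as++bs = ↭.shift x as bs
    u' : Unique (x ∷ as ++ bs)
    u' = Unique-↭ x∷as++bs uy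
    xs↭ : xs ↭ as ++ bs
    xs↭ = Unique-⊆-⊇⇒↭ (AllPairs.tail ux) (AllPairs.tail u')
      (λ z z∈ → ∈-remove (⊆ z (there z∈)) (head-∉ ux z∈))
      (λ z z∈ → tail-∈ (⊇ z (↭.∈-resp-↭ (↭-sym x∷as++bs) (there z∈))) (head-∉ u' z∈))
      where
      tail-∈ : ∀ {z} → z ∈ x ∷ xs → z ≢ x → z ∈ xs
      tail-∈ (here e)  ne = ⊥-elim (ne e)
      tail-∈ (there p) _  = p

  map-Unique : ∀ {B : Set} (f : B → A) xs → Unique xs →
               (∀ x y → x ∈ xs → y ∈ xs → f x ≡ f y → x ≡ y) → Unique (map f xs)
  map-Unique f []       _        _   = []
  map-Unique f (x ∷ xs) (x∉ ∷ u) inj =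
    All.tabulate (λ z∈ fx≡z → let (w , w∈ , z≡fw) = ∈-map⁻ f z∈ in
      All.lookup x∉ w∈ (inj x w (here refl) (there w∈) (trans fx≡z z≡fw))) ∷
    map-Unique f xs u (λ a b a∈ b∈ → inj a b (there a∈) (there b∈))

  Unique-map⇒injective : ∀ {B : Set} (f : B → A) xs → Unique (map f xs) →
                         ∀ {x y} → x ∈ xs → y ∈ xs → f x ≡ f y → x ≡ y
  Unique-map⇒injective f (z ∷ zs) u       (here refl) (here refl) e = refl
  Unique-map⇒injective f (z ∷ zs) (a ∷ u) (here refl) (there y∈)  e = ⊥-elim (All.lookup a (∈-map⁺ f y∈) e)
  Unique-map⇒injective f (z ∷ zs) (a ∷ u) (there x∈)  (here refl) e = ⊥-elim (All.lookup a (∈-map⁺ f x∈) (sym e))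
  Unique-map⇒injective f (z ∷ zs) (a ∷ u) (there x∈)  (there y∈)  e = Unique-map⇒injective f zs u x∈ y∈ e

Unique-⊆-length≥⇒⊇ : ∀ {xs ys : List ℕ} → Unique xs → (∀ x → x ∈ xs → x ∈ ys) →
                     length ys ≤ length xs → ∀ y → y ∈ ys → y ∈ xs
Unique-⊆-length≥⇒⊇ {xs} u ⊆ys len y y∈ys with y ∈? xs
... | yes y∈xs = y∈xs
... | no  y∉xs = ⊥-elim (1+n≰n (≤-trans (Unique-⊆⇒length≤ (y∉ ∷ u) ⊆ys′) len))
  where
  y∉ : All (y ≢_) xs
  y∉ = All.tabulate (λ z∈ y≡z → y∉xs (subst (_∈ xs) (sym y≡z) z∈))
  ⊆ys′ : ∀ z → z ∈ y ∷ xs → z ∈ _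
  ⊆ys′ z (here refl) = y∈ys
  ⊆ys′ z (there z∈)  = ⊆ys z z∈

Unique-++ʳ : ∀ {A : Set} (xs : List A) {ys} → Unique (xs ++ ys) → Unique ys
Unique-++ʳ []       u       = u
Unique-++ʳ (x ∷ xs) (_ ∷ u) = Unique-++ʳ xs u

Unique-++-disjoint : ∀ {A : Set} (xs : List A) {ys v} → Unique (xs ++ ys) → v ∈ xs → v ∉ ys
Unique-++-disjoint (x ∷ xs) (x∉ ∷ u) (here refl) v∈ys = All.lookup x∉ (∈-++⁺ʳ xs v∈ys) refl
Unique-++-disjoint (x ∷ xs) (_ ∷ u)  (there v∈)  v∈ys = Unique-++-disjoint xs u v∈ v∈ys

Linked<-head< : ∀ {x : ℕ} {xs z} → Linked _<_ (x ∷ xs) → z ∈ xs → x < z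
Linked<-head< (x<y ∷ l) = All.lookup (Linked⇒All <-trans x<y l)

Linked<-head≤ : ∀ {x : ℕ} {xs z} → Linked _<_ (x ∷ xs) → z ∈ x ∷ xs → x ≤ z
Linked<-head≤ l (here refl) = ≤-refl
Linked<-head≤ l (there z∈)  = <⇒≤ (Linked<-head< l z∈)

Linked<-≡ : ∀ (xs ys : List ℕ) → Linked _<_ xs → Linked _<_ ys →
            (∀ k → k ∈ xs → k ∈ ys) → (∀ k → k ∈ ys → k ∈ xs) → xs ≡ ys
Linked<-≡ []       []       _  _  _  _  = refl
Linked<-≡ []       (y ∷ ys) _  _  _  ⊇ with ⊇ y (here refl)
... | ()
Linked<-≡ (x ∷ xs) []       _  _  ⊆  _ with ⊆ x (here refl)
... | ()
Linked<-≡ (x ∷ xs) (y ∷ ys) lx ly ⊆ ⊇ =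
  cong₂ _∷_ x≡y (Linked<-≡ xs ys (Linked.tail lx) (Linked.tail ly)
    (λ k k∈ → tail-∈ (⊆ k (there k∈)) (λ k≡y → <-irrefl (trans x≡y (sym k≡y)) (Linked<-head< lx k∈)))
    (λ k k∈ → tail-∈ (⊇ k (there k∈)) (λ k≡x → <-irrefl (trans (sym x≡y) (sym k≡x)) (Linked<-head< ly k∈))))
  where
  x≡y : x ≡ y
  x≡y = ≤-antisym (Linked<-head≤ lx (⊇ y (here refl))) (Linked<-head≤ ly (⊆ x (here refl)))
  tail-∈ : ∀ {k z} {zs : List ℕ} → k ∈ z ∷ zs → k ≢ z → k ∈ zs
  tail-∈ (here e)  ne = ⊥-elim (ne e)
  tail-∈ (there p) _  = p

-- Tableaux as lists of rows

lookupD-∈ : ∀ ρ j → j < length ρ → lookupD ρ j ∈ ρ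
lookupD-∈ (x ∷ ρ) zero    _       = here refl
lookupD-∈ (x ∷ ρ) (suc j) (s≤s p) = there (lookupD-∈ ρ j p)

lookupD-Linked< : ∀ ρ → Linked _<_ ρ → ∀ j j' → j < j' → j' < length ρ → lookupD ρ j < lookupD ρ j'
lookupD-Linked< (x ∷ ρ) l zero    (suc j') _          (s≤s p) = Linked<-head< l (lookupD-∈ ρ j' p)
lookupD-Linked< (x ∷ ρ) l (suc j) (suc j') (s≤s j<j') (s≤s p) = lookupD-Linked< ρ (Linked.tail l) j j' j<j' p

lookupD-map : ∀ (f : ℕ → ℕ) → f 0 ≡ 0 → ∀ ρ j → lookupD (map f ρ) j ≡ f (lookupD ρ j)
lookupD-map f f0 []      j       = sym f0
lookupD-map f f0 (x ∷ ρ) zero    = refl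
lookupD-map f f0 (x ∷ ρ) (suc j) = lookupD-map f f0 ρ j

lookupD-applyUpTo : ∀ (h : ℕ → ℕ) m r → r < m → lookupD (applyUpTo h m) r ≡ h r
lookupD-applyUpTo h (suc m) zero    _       = refl
lookupD-applyUpTo h (suc m) (suc r) (s≤s p) = lookupD-applyUpTo (h ∘ suc) m r p

lookupD-map-upTo : ∀ (g : ℕ → ℕ) m r → r < m → lookupD (map g (upTo m)) r ≡ g r
lookupD-map-upTo g m r p = trans (cong (λ l → lookupD l r) (map-applyUpTo id g m)) (lookupD-applyUpTo g m r p)

map-lookupD-upTo : ∀ ρ → map (lookupD ρ) (upTo (length ρ)) ≡ ρ
map-lookupD-upTo []      = refl
map-lookupD-upTo (x ∷ ρ) = cong (x ∷_) (begin
  map (lookupD (x ∷ ρ)) (applyUpTo suc (length ρ)) ≡⟨ map-applyUpTo suc (lookupD (x ∷ ρ)) (length ρ) ⟩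
  applyUpTo (lookupD ρ) (length ρ)                 ≡⟨ sym (map-applyUpTo id (lookupD ρ) (length ρ)) ⟩
  map (lookupD ρ) (upTo (length ρ))                ≡⟨ map-lookupD-upTo ρ ⟩
  ρ                                                ∎)
  where open ≡-Reasoning

length-map-upTo : ∀ {A : Set} (g : ℕ → A) m → length (map g (upTo m)) ≡ m
length-map-upTo g m = trans (length-map g (upTo m)) (length-applyUpTo id m)

rowD-applyUpTo : ∀ (h : ℕ → List ℕ) m r → r < m → rowD (applyUpTo h m) r ≡ h r
rowD-applyUpTo h (suc m) zero    _       = refl
rowD-applyUpTo h (suc m) (suc r) (s≤s p) = rowD-applyUpTo (h ∘ suc) m r p

rowD-map-upTo : ∀ (g : ℕ → List ℕ) m r → r < m → rowD (map g (upTo m)) r ≡ g r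
rowD-map-upTo g m r p = trans (cong (λ l → rowD l r) (map-applyUpTo id g m)) (rowD-applyUpTo g m r p)

map-rowD-upTo : ∀ (T : Tab) → map (rowD T) (upTo (length T)) ≡ T
map-rowD-upTo []      = refl
map-rowD-upTo (ρ ∷ T) = cong (ρ ∷_) (begin
  map (rowD (ρ ∷ T)) (applyUpTo suc (length T)) ≡⟨ map-applyUpTo suc (rowD (ρ ∷ T)) (length T) ⟩
  applyUpTo (rowD T) (length T)                 ≡⟨ sym (map-applyUpTo id (rowD T) (length T)) ⟩
  map (rowD T) (upTo (length T))                ≡⟨ map-rowD-upTo T ⟩
  T                                             ∎)
  where open ≡-Reasoning

rowD-map-map : ∀ (f : ℕ → ℕ) T r → rowD (map (map f) T) r ≡ map f (rowD T r)
rowD-map-map f []      r       = refl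
rowD-map-map f (ρ ∷ T) zero    = refl
rowD-map-map f (ρ ∷ T) (suc r) = rowD-map-map f T r

rowD-∈ : ∀ (T : Tab) r → r < length T → rowD T r ∈ T
rowD-∈ (ρ ∷ T) zero    _       = here refl
rowD-∈ (ρ ∷ T) (suc r) (s≤s p) = there (rowD-∈ T r p)

∈-rowD⇒∈-concat : ∀ {k} T r → k ∈ rowD T r → k ∈ concat T
∈-rowD⇒∈-concat (ρ ∷ T) zero    k∈ = ∈-++⁺ˡ k∈
∈-rowD⇒∈-concat (ρ ∷ T) (suc r) k∈ = ∈-++⁺ʳ ρ (∈-rowD⇒∈-concat T r k∈)

any-≡ᵇ-∈ : ∀ {k} ρ → k ∈ ρ → any (k ≡ᵇ_) ρ ≡ true
any-≡ᵇ-∈ (x ∷ ρ) (here refl) rewrite ≡ᵇ-true (refl {x = x}) = refl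
any-≡ᵇ-∈ {k} (x ∷ ρ) (there p) rewrite any-≡ᵇ-∈ ρ p with k ≡ᵇ x
... | true  = refl
... | false = refl

any-≡ᵇ-∉ : ∀ {k} ρ → k ∉ ρ → any (k ≡ᵇ_) ρ ≡ false
any-≡ᵇ-∉ []          _ = refl
any-≡ᵇ-∉ {k} (x ∷ ρ) p rewrite ≡ᵇ-false {k} {x} (p ∘ here) = any-≡ᵇ-∉ ρ (p ∘ there)

any-≡ᵇ⇒∈ : ∀ {k} ρ → any (k ≡ᵇ_) ρ ≡ true → k ∈ ρ
any-≡ᵇ⇒∈ {k} (x ∷ ρ) e with k ≟ x
... | yes k≡x = here k≡x
... | no  k≢x rewrite ≡ᵇ-false k≢x = there (any-≡ᵇ⇒∈ ρ e)

rowOf-∈rowD : ∀ {k} T r → Unique (concat T) → k ∈ rowD T r → rowOf k T ≡ r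
rowOf-∈rowD (ρ ∷ T) zero    u k∈ rewrite any-≡ᵇ-∈ ρ k∈ = refl
rowOf-∈rowD (ρ ∷ T) (suc r) u k∈
  rewrite any-≡ᵇ-∉ ρ (λ k∈ρ → Unique-++-disjoint ρ u k∈ρ (∈-rowD⇒∈-concat T r k∈))
  = cong suc (rowOf-∈rowD T r (Unique-++ʳ ρ u) k∈)

∈-rowD-rowOf : ∀ {k} T → k ∈ concat T → k ∈ rowD T (rowOf k T)
∈-rowD-rowOf {k} (ρ ∷ T) k∈ with any (k ≡ᵇ_) ρ in e
... | true  = any-≡ᵇ⇒∈ ρ e
... | false with ∈-++⁻ ρ k∈
...   | inj₁ k∈ρ = contradiction (trans (sym e) (any-≡ᵇ-∈ ρ k∈ρ)) λ ()
...   | inj₂ k∈T = ∈-rowD-rowOf T k∈T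

-- the transposition (i  i+1); swapT i T is map (map (σ i)) T by definition
σ : ℕ → ℕ → ℕ
σ i x = if x ≡ᵇ i then suc i else (if x ≡ᵇ suc i then i else x)

σ-i : ∀ i → σ i i ≡ suc i
σ-i i rewrite ≡ᵇ-true (refl {x = i}) = refl

σ-1+i : ∀ i → σ i (suc i) ≡ i
σ-1+i i rewrite ≡ᵇ-false {suc i} {i} 1+n≢n | ≡ᵇ-true (refl {x = suc i}) = refl

σ-fix : ∀ i x → x ≢ i → x ≢ suc i → σ i x ≡ x
σ-fix i x x≢i x≢1+i rewrite ≡ᵇ-false x≢i | ≡ᵇ-false x≢1+i = refl

data σView (i x : ℕ) : Set where
  at-i    : x ≡ i → σ i x ≡ suc i → σView i x
  at-1+i  : x ≡ suc i → σ i x ≡ i → σView i x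
  outside : x ≢ i → x ≢ suc i → σ i x ≡ x → σView i x

σ-view : ∀ i x → σView i x
σ-view i x with x ≟ i
... | yes refl = at-i refl (σ-i i)
... | no x≢i with x ≟ suc i
...   | yes refl  = at-1+i refl (σ-1+i i)
...   | no x≢1+i = outside x≢i x≢1+i (σ-fix i x x≢i x≢1+i)

σ-involutive : ∀ i x → σ i (σ i x) ≡ x
σ-involutive i x with σ-view i x
... | at-i    refl e = trans (cong (σ i) e) (σ-1+i i)
... | at-1+i  refl e = trans (cong (σ i) e) (σ-i i)
... | outside _ _  e = trans (cong (σ i) e) e

σ-injective : ∀ i {x y} → σ i x ≡ σ i y → x ≡ y
σ-injective i {x} {y} e = trans (sym (σ-involutive i x)) (trans (cong (σ i) e) (σ-involutive i y))

σ-0 : ∀ i → 1 ≤ i → σ i 0 ≡ 0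
σ-0 (suc i) _ = refl

σ-suc : ∀ i x → σ (suc i) (suc x) ≡ suc (σ i x)
σ-suc i x with σ-view i x
... | at-i    refl e = trans (σ-i (suc i)) (cong suc (sym e))
... | at-1+i  refl e = trans (σ-1+i (suc i)) (cong suc (sym e))
... | outside x≢i x≢1+i e =
  trans (σ-fix (suc i) (suc x) (x≢i ∘ suc-injective) (x≢1+i ∘ suc-injective)) (cong suc (sym e))

σ-mono-< : ∀ i {a b} → a < b → ¬ (a ≡ i × b ≡ suc i) → σ i a < σ i b
σ-mono-< i {a} {b} a<b not-i,1+i with σ-view i a | σ-view i b
... | at-i    p _      | at-i    q _      = ⊥-elim (<-irrefl (trans p (sym q)) a<b)
... | at-i    p _      | at-1+i  q _      = ⊥-elim (not-i,1+i (p , q))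
... | at-i    refl e   | outside _ q f    rewrite e | f = ≤∧≢⇒< a<b (q ∘ sym)
... | at-1+i  refl _   | at-i    refl _   = ⊥-elim (<-asym a<b (n<1+n i))
... | at-1+i  p _      | at-1+i  q _      = ⊥-elim (<-irrefl (trans p (sym q)) a<b)
... | at-1+i  refl e   | outside _ _ f    rewrite e | f = <-trans (n<1+n i) a<b
... | outside _ _ e    | at-i    refl f   rewrite e | f = <-trans a<b (n<1+n i)
... | outside p _ e    | at-1+i  refl f   rewrite e | f = ≤∧≢⇒< (≤-pred a<b) p
... | outside _ _ e    | outside _ _ f    rewrite e | f = a<b

swapT-involutive : ∀ i T → swapT i (swapT i T) ≡ T
swapT-involutive i T = begin
  map (map (σ i)) (map (map (σ i)) T) ≡⟨ sym (map-∘ T) ⟩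
  map (map (σ i) ∘ map (σ i)) T       ≡⟨ map-cong (λ ρ → trans (sym (map-∘ ρ)) (map-id-σ ρ)) T ⟩
  map (λ ρ → ρ) T                     ≡⟨ map-id T ⟩
  T                                   ∎
  where
  open ≡-Reasoning
  map-id-σ : ∀ ρ → map (σ i ∘ σ i) ρ ≡ ρ
  map-id-σ ρ = trans (map-cong (σ-involutive i) ρ) (map-id ρ)

≡ᵇ-σ : ∀ i k x → (k ≡ᵇ σ i x) ≡ (σ i k ≡ᵇ x)
≡ᵇ-σ i k x with k ≟ σ i x
... | yes e = trans (≡ᵇ-true e) (sym (≡ᵇ-true {σ i k} {x} (trans (cong (σ i) e) (σ-involutive i x))))
... | no ne = trans (≡ᵇ-false ne) (sym (≡ᵇ-false {σ i k} {x} (λ e → ne (trans (sym (σ-involutive i k)) (cong (σ i) e)))))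

any-map-σ : ∀ i k ρ → any (k ≡ᵇ_) (map (σ i) ρ) ≡ any (σ i k ≡ᵇ_) ρ
any-map-σ i k []      = refl
any-map-σ i k (x ∷ ρ) = cong₂ _∨_ (≡ᵇ-σ i k x) (any-map-σ i k ρ)

rowOf-swapT : ∀ i k T → rowOf k (swapT i T) ≡ rowOf (σ i k) T
rowOf-swapT i k []      = refl
rowOf-swapT i k (ρ ∷ T) rewrite any-map-σ i k ρ | rowOf-swapT i k T = refl

entry-swapT : ∀ β i T r c → 1 ≤ i → entry β (swapT i T) r c ≡ σ i (entry β T r c)
entry-swapT β i T r c 1≤i rewrite rowD-map-map (σ i) T r =
  lookupD-map (σ i) (σ-0 i 1≤i) (rowD T r) (c ∸ part β r)

-- Inversions

∑-σ : ∀ h j n → suc j < n → ∑ h n ≡ ∑ (h ∘ σ j) n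
∑-σ h j n 1+j<n = subst (λ N → ∑ h N ≡ ∑ (h ∘ σ j) N) (m∸n+n≡m 1+j<n) (shifted (n ∸ suc (suc j)))
  where
  open ≡-Reasoning
  below : ∀ x → x < j → h x ≡ h (σ j x)
  below x x<j = cong h (sym (σ-fix j x (<⇒≢ x<j) (<⇒≢ (m<n⇒m<1+n x<j))))
  shifted : ∀ m → ∑ h (m + suc (suc j)) ≡ ∑ (h ∘ σ j) (m + suc (suc j))
  shifted zero = begin
    ∑ h j + h j + h (suc j)                 ≡⟨ cong (λ s → s + h j + h (suc j)) (∑-cong j below) ⟩
    ∑ (h ∘ σ j) j + h j + h (suc j)         ≡⟨ +-right-comm (∑ (h ∘ σ j) j) (h j) (h (suc j)) ⟩
    ∑ (h ∘ σ j) j + h (suc j) + h j         ≡⟨ sym (cong₂ (λ u v → ∑ (h ∘ σ j) j + h u + h v) (σ-i j) (σ-1+i j)) ⟩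
    ∑ (h ∘ σ j) (suc (suc j))               ∎
  shifted (suc m) = cong₂ _+_ (shifted m) (cong h (sym (σ-fix j x (λ e → <⇒≢ (<-trans (n<1+n j) big) (sym e))
                                                                  (λ e → <⇒≢ big (sym e)))))
    where
    x : ℕ
    x = m + suc (suc j)
    big : suc j < x
    big = m≤n+m (suc (suc j)) m

σ-<ᵇ : ∀ j a b → ¬ (a ≡ j × b ≡ suc j) → ¬ (a ≡ suc j × b ≡ j) → (σ j a <ᵇ σ j b) ≡ (a <ᵇ b)
σ-<ᵇ j a b not-j,1+j not-1+j,j with a <? b
... | yes a<b = trans (<ᵇ-true (σ-mono-< j a<b not-j,1+j)) (sym (<ᵇ-true a<b))
... | no  a≮b = flip (<ᵇ-false a≮b) (<ᵇ-false {σ j a} {σ j b} (λ σa<σb → a≮b (subst₂ _<_ (σ-involutive j a) (σ-involutive j b)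
                  (σ-mono-< j σa<σb (λ (p , q) → not-1+j,j (σ-at p (σ-i j) , σ-at q (σ-1+i j)))))))
  where
  σ-at : ∀ {x y z} → σ j x ≡ y → σ j y ≡ z → x ≡ z
  σ-at {x} refl e = trans (sym (σ-involutive j x)) e
  flip : ∀ {u v : Bool} → u ≡ false → v ≡ false → v ≡ u
  flip p q = trans q (sym p)

≡ᵇ-pair-false : ∀ {a b p q} → ¬ (a ≡ p × b ≡ q) → ∀ c → ((a ≡ᵇ p) ∧ ((b ≡ᵇ q) ∧ c)) ≡ false
≡ᵇ-pair-false {a} {b} {p} {q} h c with a ≟ p
... | no  a≢p rewrite ≡ᵇ-false a≢p = refl
... | yes a≡p rewrite ≡ᵇ-true a≡p | ≡ᵇ-false {b} {q} (λ e → h (a≡p , e)) = refl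

∑∑-point : ∀ p q n c → p < n → q < n → ∑ (λ b → ∑ (λ a → 𝟙 ((a ≡ᵇ p) ∧ ((b ≡ᵇ q) ∧ c))) n) n ≡ 𝟙 c
∑∑-point p q n c p<n q<n = trans (∑-cong n (λ b _ → ∑-point p n ((b ≡ᵇ q) ∧ c) p<n)) (∑-point q n c q<n)

∑∑-distrib-+ : ∀ (X Y : ℕ → ℕ → ℕ) n →
  ∑ (λ b → ∑ (λ a → X a b + Y a b) n) n ≡ ∑ (λ b → ∑ (λ a → X a b) n) n + ∑ (λ b → ∑ (λ a → Y a b) n) n
∑∑-distrib-+ X Y n = trans (∑-cong n (λ b _ → ∑-distrib-+ (λ a → X a b) (λ a → Y a b) n)) (∑-distrib-+ _ _ n)

-- The positions are 1 … n, while the bound variables a, b of the sums run over 0 … n-1.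
inversions : (ℕ → ℕ) → ℕ → ℕ
inversions f n = ∑ (λ b → ∑ (λ a → 𝟙 ((a <ᵇ b) ∧ (f (suc b) <ᵇ f (suc a)))) n) n

inversions-cong : ∀ {f g} n → (∀ k → 1 ≤ k → k ≤ n → f k ≡ g k) → inversions f n ≡ inversions g n
inversions-cong n h = ∑-cong n (λ b b<n → ∑-cong n (λ a a<n →
  cong₂ (λ u v → 𝟙 ((a <ᵇ b) ∧ (u <ᵇ v))) (h (suc b) (s≤s z≤n) b<n) (h (suc a) (s≤s z≤n) a<n)))

inversions≤n*n : ∀ f n → inversions f n ≤ n * n
inversions≤n*n f n = ≤-trans (∑-mono-≤ n (λ b _ → ∑𝟙≤ _ n)) (≤-reflexive (∑-const n n))

inversions-monotone : ∀ f n → (∀ a b → a < b → b < n → f (suc a) ≤ f (suc b)) → inversions f n ≡ 0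
inversions-monotone f n mono = ∑-zero n (λ b b<n → ∑-zero n (λ a _ → no-inversion a b b<n))
  where
  no-inversion : ∀ a b → b < n → 𝟙 ((a <ᵇ b) ∧ (f (suc b) <ᵇ f (suc a))) ≡ 0
  no-inversion a b b<n with a <? b
  ... | yes a<b rewrite <ᵇ-true a<b | <ᵇ-false (≤⇒≯ (mono a b a<b b<n)) = refl
  ... | no  a≮b rewrite <ᵇ-false a≮b = refl

inversion-σ-off-pair : ∀ j (F : ℕ → ℕ) a b → ¬ (a ≡ j × b ≡ suc j) → ¬ (a ≡ suc j × b ≡ j) →
  𝟙 ((σ j a <ᵇ σ j b) ∧ (F b <ᵇ F a)) + 𝟙 ((a ≡ᵇ j) ∧ ((b ≡ᵇ suc j) ∧ (F (suc j) <ᵇ F j)))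
  ≡ 𝟙 ((a <ᵇ b) ∧ (F b <ᵇ F a)) + 𝟙 ((a ≡ᵇ suc j) ∧ ((b ≡ᵇ j) ∧ (F j <ᵇ F (suc j))))
inversion-σ-off-pair j F a b n₁ n₂
  rewrite σ-<ᵇ j a b n₁ n₂ | ≡ᵇ-pair-false n₁ (F (suc j) <ᵇ F j) | ≡ᵇ-pair-false n₂ (F j <ᵇ F (suc j)) = refl

inversion-σ-pointwise : ∀ j (F : ℕ → ℕ) a b →
  𝟙 ((σ j a <ᵇ σ j b) ∧ (F b <ᵇ F a)) + 𝟙 ((a ≡ᵇ j) ∧ ((b ≡ᵇ suc j) ∧ (F (suc j) <ᵇ F j)))
  ≡ 𝟙 ((a <ᵇ b) ∧ (F b <ᵇ F a)) + 𝟙 ((a ≡ᵇ suc j) ∧ ((b ≡ᵇ j) ∧ (F j <ᵇ F (suc j))))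
inversion-σ-pointwise j F a b with a ≟ j | b ≟ suc j | a ≟ suc j | b ≟ j
... | yes refl | yes refl | _ | _
  rewrite σ-i j | σ-1+i j | <ᵇ-false (<-asym (n<1+n j)) | <ᵇ-true (n<1+n j)
        | ≡ᵇ-true (refl {x = j}) | ≡ᵇ-false {j} {suc j} (1+n≢n ∘ sym)
  = +-comm 0 (𝟙 (F (suc j) <ᵇ F j))
... | _ | _ | yes refl | yes refl
  rewrite σ-i j | σ-1+i j | <ᵇ-false (<-asym (n<1+n j)) | <ᵇ-true (n<1+n j)
        | ≡ᵇ-true (refl {x = j}) | ≡ᵇ-false {suc j} {j} 1+n≢n
  = +-identityʳ _
... | yes a≡j | no b≢1+j | _        | _      =
  inversion-σ-off-pair j F a b (b≢1+j ∘ proj₂) (λ (a≡1+j , _) → 1+n≢n (trans (sym a≡1+j) a≡j))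
... | no a≢j  | _        | yes _    | no b≢j = inversion-σ-off-pair j F a b (a≢j ∘ proj₁) (b≢j ∘ proj₂)
... | no a≢j  | _        | no a≢1+j | _      = inversion-σ-off-pair j F a b (a≢j ∘ proj₁) (a≢1+j ∘ proj₁)

inversions-σ : ∀ f j n → suc j < n →
  inversions (f ∘ σ (suc j)) n + 𝟙 (f (suc (suc j)) <ᵇ f (suc j)) ≡ inversions f n + 𝟙 (f (suc j) <ᵇ f (suc (suc j)))
inversions-σ f j n 1+j<n = begin
  inversions (f ∘ σ (suc j)) n + 𝟙 c₁ ≡⟨ cong (_+ 𝟙 c₁) reindexed ⟩
  ∑∑ X + 𝟙 c₁                        ≡⟨ cong (∑∑ X +_) (sym (∑∑-point j (suc j) n c₁ j<n 1+j<n)) ⟩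
  ∑∑ X + ∑∑ D₁                       ≡⟨ sym (∑∑-distrib-+ X D₁ n) ⟩
  ∑∑ (λ a b → X a b + D₁ a b)        ≡⟨ ∑-cong n (λ b _ → ∑-cong n (λ a _ → inversion-σ-pointwise j F a b)) ⟩
  ∑∑ (λ a b → Y a b + D₂ a b)        ≡⟨ ∑∑-distrib-+ Y D₂ n ⟩
  ∑∑ Y + ∑∑ D₂                       ≡⟨ cong (∑∑ Y +_) (∑∑-point (suc j) j n c₂ 1+j<n j<n) ⟩
  inversions f n + 𝟙 c₂              ∎
  where
  open ≡-Reasoning
  j<n : j < n
  j<n = <-trans (n<1+n j) 1+j<n
  F : ℕ → ℕ
  F x = f (suc x)
  c₁ c₂ : Bool
  c₁ = F (suc j) <ᵇ F j
  c₂ = F j <ᵇ F (suc j)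
  ∑∑ : (ℕ → ℕ → ℕ) → ℕ
  ∑∑ Z = ∑ (λ b → ∑ (λ a → Z a b) n) n
  X Y D₁ D₂ : ℕ → ℕ → ℕ
  X a b  = 𝟙 ((σ j a <ᵇ σ j b) ∧ (F b <ᵇ F a))
  Y a b  = 𝟙 ((a <ᵇ b) ∧ (F b <ᵇ F a))
  D₁ a b = 𝟙 ((a ≡ᵇ j) ∧ ((b ≡ᵇ suc j) ∧ c₁))
  D₂ a b = 𝟙 ((a ≡ᵇ suc j) ∧ ((b ≡ᵇ j) ∧ c₂))
  reindexed : inversions (f ∘ σ (suc j)) n ≡ ∑∑ X
  reindexed = begin
    inversions (f ∘ σ (suc j)) n
      ≡⟨ ∑-cong n (λ b _ → ∑-cong n (λ a _ →
           cong₂ (λ u v → 𝟙 ((a <ᵇ b) ∧ (f u <ᵇ f v))) (σ-suc j b) (σ-suc j a))) ⟩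
    ∑∑ (λ a b → 𝟙 ((a <ᵇ b) ∧ (F (σ j b) <ᵇ F (σ j a))))
      ≡⟨ ∑-cong n (λ b _ → trans (∑-σ _ j n 1+j<n) (∑-cong n (λ a _ →
           cong (λ u → 𝟙 ((σ j a <ᵇ b) ∧ (F (σ j b) <ᵇ F u))) (σ-involutive j a)))) ⟩
    ∑∑ (λ a b → 𝟙 ((σ j a <ᵇ b) ∧ (F (σ j b) <ᵇ F a)))
      ≡⟨ trans (∑-σ _ j n 1+j<n) (∑-cong n (λ b _ → ∑-cong n (λ a _ →
           cong (λ u → 𝟙 ((σ j a <ᵇ σ j b) ∧ (F u <ᵇ F a))) (σ-involutive j b)))) ⟩
    ∑∑ X ∎

-- Counting

count-upTo : ∀ (p : ℕ → Bool) m → count p (upTo m) ≡ ∑ (𝟙 ∘ p) m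
count-upTo p m = trans (count≡∑ₗ (upTo m)) (sum-map-upTo (𝟙 ∘ p) m)
  where
  count≡∑ₗ : ∀ xs → count p xs ≡ ∑ₗ (𝟙 ∘ p) xs
  count≡∑ₗ []       = refl
  count≡∑ₗ (x ∷ xs) with p x
  ... | true  = cong suc (count≡∑ₗ xs)
  ... | false = count≡∑ₗ xs

∑𝟙-< : ∀ w m → ∑ (λ k → 𝟙 (k <ᵇ w)) m ≡ m ⊓ w
∑𝟙-< w zero    = refl
∑𝟙-< w (suc m) rewrite ∑𝟙-< w m with m <? w
... | yes m<w rewrite <ᵇ-true m<w | m≤n⇒m⊓n≡m (<⇒≤ m<w) | m≤n⇒m⊓n≡m m<w = +-comm m 1
... | no  m≮w rewrite <ᵇ-false m≮w | m≥n⇒m⊓n≡n (≮⇒≥ m≮w) | m≥n⇒m⊓n≡n (≤-trans (≮⇒≥ m≮w) (n≤1+n m)) =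
  +-identityʳ _

∑𝟙-interval : ∀ b a c → ∑ (λ c' → 𝟙 ((b ≤ᵇ c') ∧ (c' <ᵇ a))) c ≡ (c ⊓ a) ∸ b
∑𝟙-interval b a zero    = sym (0∸n≡0 b)
∑𝟙-interval b a (suc c) rewrite ∑𝟙-interval b a c with c <? a
... | no c≮a rewrite <ᵇ-false c≮a | ∧-zeroʳ (b ≤ᵇ c) | m≥n⇒m⊓n≡n (≮⇒≥ c≮a)
                   | m≥n⇒m⊓n≡n (≤-trans (≮⇒≥ c≮a) (n≤1+n c)) = +-identityʳ _
... | yes c<a rewrite <ᵇ-true c<a | ∧-identityʳ (b ≤ᵇ c) | m≤n⇒m⊓n≡m (<⇒≤ c<a) | m≤n⇒m⊓n≡m c<a
  with b ≤? c
... | yes b≤c rewrite ≤ᵇ-true b≤c = trans (+-comm _ 1) (sym (+-∸-assoc 1 b≤c))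
... | no  b≰c rewrite ≤ᵇ-false b≰c =
  trans (+-identityʳ _) (trans (m≤n⇒m∸n≡0 (<⇒≤ (≰⇒> b≰c))) (sym (m≤n⇒m∸n≡0 (≰⇒> b≰c))))

+-<⇒<∸ : ∀ b c m → b + m < c → m < c ∸ b
+-<⇒<∸ b c m p = subst (_< c ∸ b) (m+n∸m≡n b m) (∸-monoˡ-< p (m≤m+n b m))

+-≮⇒∸≤ : ∀ b c m → ¬ b + m < c → c ∸ b ≤ m
+-≮⇒∸≤ b c m p = subst (c ∸ b ≤_) (m+n∸m≡n b m) (∸-monoˡ-≤ b (≮⇒≥ p))

∑𝟙-shifted-< : ∀ b c m → ∑ (λ j → 𝟙 (b + j <ᵇ c)) m ≡ m ⊓ (c ∸ b)
∑𝟙-shifted-< b c zero    = refl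
∑𝟙-shifted-< b c (suc m) rewrite ∑𝟙-shifted-< b c m with b + m <? c
... | yes lt rewrite <ᵇ-true lt | m≤n⇒m⊓n≡m (<⇒≤ (+-<⇒<∸ b c m lt)) | m≤n⇒m⊓n≡m (+-<⇒<∸ b c m lt) = +-comm m 1
... | no nlt rewrite <ᵇ-false nlt | m≥n⇒m⊓n≡n (+-≮⇒∸≤ b c m nlt)
                   | m≥n⇒m⊓n≡n (≤-trans (+-≮⇒∸≤ b c m nlt) (n≤1+n m)) = +-identityʳ _

∑𝟙-shifted-≡ : ∀ b c m D → ∑ (λ j → 𝟙 ((b + j ≡ᵇ c) ∧ D)) m ≡ 𝟙 ((b ≤ᵇ c) ∧ ((c <ᵇ b + m) ∧ D))
∑𝟙-shifted-≡ b c m D with b ≤? c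
... | no b≰c rewrite ≤ᵇ-false b≰c =
  ∑-zero m (λ j _ → cong (λ z → 𝟙 (z ∧ D)) (≡ᵇ-false (λ e → b≰c (subst (b ≤_) e (m≤m+n b j)))))
... | yes b≤c rewrite ≤ᵇ-true b≤c with c <? b + m
...   | no c≮b+m rewrite <ᵇ-false c≮b+m =
  ∑-zero m (λ j j<m → cong (λ z → 𝟙 (z ∧ D)) (≡ᵇ-false (λ e → c≮b+m (subst (_< b + m) e (+-monoʳ-< b j<m)))))
...   | yes c<b+m rewrite <ᵇ-true c<b+m =
  trans (∑-cong m (λ j _ → cong (λ z → 𝟙 (z ∧ D)) (shift j))) (∑-point (c ∸ b) m D c∸b<m)
  where
  c∸b<m : c ∸ b < m
  c∸b<m = +-cancelˡ-< b _ _ (subst (_< b + m) (sym (m+[n∸m]≡n b≤c)) c<b+m)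
  shift : ∀ j → (b + j ≡ᵇ c) ≡ (j ≡ᵇ c ∸ b)
  shift j with j ≟ c ∸ b
  ... | yes e = trans (≡ᵇ-true (trans (cong (b +_) e) (m+[n∸m]≡n b≤c))) (sym (≡ᵇ-true e))
  ... | no ne = trans (≡ᵇ-false (λ e → ne (trans (sym (m+n∸m≡n b j)) (cong (_∸ b) e)))) (sym (≡ᵇ-false ne))

∑-id≡C2 : ∀ m → ∑ (λ b → b) m ≡ m C 2
∑-id≡C2 zero    = refl
∑-id≡C2 (suc m) =
  trans (cong₂ _+_ (∑-id≡C2 m) (sym (nC1≡n m))) (trans (+-comm (m C 2) (m C 1)) (nCk+nC[k+1]≡[n+1]C[k+1] m 1))

pairs≡C2 : ∀ m → ∑ (λ b → ∑ (λ a → 𝟙 (a <ᵇ b)) m) m ≡ m C 2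
pairs≡C2 m = trans (∑-cong m (λ b b<m → trans (∑𝟙-< b m) (m≥n⇒m⊓n≡n (<⇒≤ b<m)))) (∑-id≡C2 m)

<∸⇒+< : ∀ b a j → j < a ∸ b → b + j < a
<∸⇒+< b a j j<a∸b with b ≤? a
... | yes b≤a = subst (b + j <_) (m+[n∸m]≡n b≤a) (+-monoʳ-< b j<a∸b)
... | no  b≰a rewrite m≤n⇒m∸n≡0 (≤-trans (n≤1+n _) (≰⇒> b≰a)) = ⊥-elim (n≮0 j<a∸b)

[1…_] : ℕ → List ℕ
[1… n ] = map suc (upTo n)

Unique-[1…] : ∀ n → Unique [1… n ]
Unique-[1…] n = Unique.map⁺ suc-injective (Unique.upTo⁺ n)

∈-[1…]⁺ : ∀ {n v} → 1 ≤ v → v ≤ n → v ∈ [1… n ]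
∈-[1…]⁺ {v = suc v} _ v<n = ∈-map⁺ suc (∈-upTo⁺ v<n)

∈-[1…]⁻ : ∀ {n v} → v ∈ [1… n ] → 1 ≤ v × v ≤ n
∈-[1…]⁻ v∈ with ∈-map⁻ suc v∈
... | j , j∈ , refl = s≤s z≤n , ∈-upTo⁻ j∈

module Tableaux (α β : List ℕ) where

  L : ℕ
  L = length α

  len : ℕ → ℕ
  len r = part α r ∸ part β r

  n : ℕ
  n = size α β

  rowCells : ℕ → List (ℕ × ℕ)
  rowCells r = map (r ,_) (colsOf α β r)

  cells : List (ℕ × ℕ)
  cells = concat (map rowCells (upTo L))

  entryAt : Tab → ℕ × ℕ → ℕ
  entryAt T (r , c) = entry β T r c

  ∈-colsOf⁺ : ∀ r c → part β r ≤ c → c < part α r → c ∈ colsOf α β r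
  ∈-colsOf⁺ r c b≤c c<a = subst (_∈ colsOf α β r) (m+[n∸m]≡n b≤c)
    (∈-map⁺ (part β r +_) (∈-upTo⁺ (∸-monoˡ-< c<a b≤c)))

  ∈-colsOf⁻ : ∀ r c → c ∈ colsOf α β r → part β r ≤ c × c < part α r
  ∈-colsOf⁻ r c c∈ with ∈-map⁻ (part β r +_) c∈
  ... | j , j∈ , refl = m≤m+n (part β r) j , <∸⇒+< (part β r) (part α r) j (∈-upTo⁻ j∈)

  ∈-cells⁺ : ∀ {r c} → InShape α β r c → (r , c) ∈ cells
  ∈-cells⁺ {r} {c} (r<L , b≤c , c<a) =
    ∈-concat⁺′ (∈-map⁺ (r ,_) (∈-colsOf⁺ r c b≤c c<a)) (∈-map⁺ rowCells (∈-upTo⁺ r<L))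

  ∈-cells⁻ : ∀ {r c} → (r , c) ∈ cells → InShape α β r c
  ∈-cells⁻ {r} {c} x∈ with ∈-concat⁻′ (map rowCells (upTo L)) x∈
  ... | xs , x∈xs , xs∈ with ∈-map⁻ rowCells xs∈
  ...   | r' , r'∈ , refl with ∈-map⁻ (r' ,_) x∈xs
  ...     | c' , c'∈ , refl = ∈-upTo⁻ r'∈ , ∈-colsOf⁻ r c c'∈

  ∑ₗ-cells : ∀ f → ∑ₗ f cells ≡ ∑ (λ r → ∑ (λ j → f (r , part β r + j)) (len r)) L
  ∑ₗ-cells f = begin
    ∑ₗ f cells                                   ≡⟨ ∑ₗ-concat f (map rowCells (upTo L)) ⟩
    ∑ₗ (∑ₗ f) (map rowCells (upTo L))            ≡⟨ ∑ₗ-map (∑ₗ f) rowCells (upTo L) ⟩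
    ∑ₗ (∑ₗ f ∘ rowCells) (upTo L)                ≡⟨ sum-map-upTo _ L ⟩
    ∑ (∑ₗ f ∘ rowCells) L                        ≡⟨ ∑-cong L (λ r _ → row r) ⟩
    ∑ (λ r → ∑ (λ j → f (r , part β r + j)) (len r)) L ∎
    where
    open ≡-Reasoning
    row : ∀ r → ∑ₗ f (rowCells r) ≡ ∑ (λ j → f (r , part β r + j)) (len r)
    row r = trans (∑ₗ-map f (r ,_) (colsOf α β r))
                  (trans (∑ₗ-map (f ∘ (r ,_)) (part β r +_) (upTo (len r))) (sum-map-upTo _ (len r)))

  rowD≡map-entry : ∀ T → HasShape α β T → ∀ r → r < L → rowD T r ≡ map (entry β T r) (colsOf α β r)
  rowD≡map-entry T (_ , lengths) r r<L = begin
    rowD T r                                            ≡⟨ sym (map-lookupD-upTo (rowD T r)) ⟩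
    map (lookupD (rowD T r)) (upTo (length (rowD T r))) ≡⟨ cong (λ m → map (lookupD (rowD T r)) (upTo m)) (lengths r r<L) ⟩
    map (lookupD (rowD T r)) (upTo (len r))
      ≡⟨ map-cong (λ j → cong (lookupD (rowD T r)) (sym (m+n∸m≡n (part β r) j))) (upTo (len r)) ⟩
    map (entry β T r ∘ (part β r +_)) (upTo (len r))    ≡⟨ map-∘ (upTo (len r)) ⟩
    map (entry β T r) (colsOf α β r)                    ∎
    where open ≡-Reasoning

  ≡-map-rowD : ∀ (T : Tab) → length T ≡ L → T ≡ map (rowD T) (upTo L)
  ≡-map-rowD T e = trans (sym (map-rowD-upTo T)) (cong (λ m → map (rowD T) (upTo m)) e)

  concat≡map-entryAt : ∀ T → HasShape α β T → concat T ≡ map (entryAt T) cells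
  concat≡map-entryAt T shape = begin
    concat T                                                       ≡⟨ cong concat (≡-map-rowD T (proj₁ shape)) ⟩
    concat (map (rowD T) (upTo L))                                 ≡⟨ cong concat (map-cong-local (All.tabulate rows)) ⟩
    concat (map (λ r → map (entryAt T) (rowCells r)) (upTo L))     ≡⟨ cong concat (map-∘ (upTo L)) ⟩
    concat (map (map (entryAt T)) (map rowCells (upTo L)))         ≡⟨ concat-map (map rowCells (upTo L)) ⟩
    map (entryAt T) cells                                          ∎
    where
    open ≡-Reasoning
    rows : ∀ {r} → r ∈ upTo L → rowD T r ≡ map (entryAt T) (rowCells r)
    rows {r} r∈ = trans (rowD≡map-entry T shape r (∈-upTo⁻ r∈)) (map-∘ (colsOf α β r))

  tableau-ext : ∀ T U → HasShape α β T → HasShape α β U →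
                (∀ r c → InShape α β r c → entry β T r c ≡ entry β U r c) → T ≡ U
  tableau-ext T U shapeT shapeU same = begin
    T                     ≡⟨ ≡-map-rowD T (proj₁ shapeT) ⟩
    map (rowD T) (upTo L) ≡⟨ map-cong-local (All.tabulate rows) ⟩
    map (rowD U) (upTo L) ≡⟨ sym (≡-map-rowD U (proj₁ shapeU)) ⟩
    U                     ∎
    where
    open ≡-Reasoning
    rows : ∀ {r} → r ∈ upTo L → rowD T r ≡ rowD U r
    rows {r} r∈ = let r<L = ∈-upTo⁻ r∈ in begin
      rowD T r                          ≡⟨ rowD≡map-entry T shapeT r r<L ⟩
      map (entry β T r) (colsOf α β r)
        ≡⟨ map-cong-local (All.tabulate (λ {c} c∈ → same r c (r<L , ∈-colsOf⁻ r c c∈))) ⟩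
      map (entry β U r) (colsOf α β r)  ≡⟨ sym (rowD≡map-entry U shapeU r r<L) ⟩
      rowD U r                          ∎

  -- an SIT without the first-column condition
  RowStandard : Tab → Set
  RowStandard T = HasShape α β T × (concat T ↭ [1… n ]) × All (Linked _<_) T

  ColumnsIncrease : Tab → Set
  ColumnsIncrease T = ∀ c r r' → r < r' → InShape α β r c → InShape α β r' c → entry β T r c < entry β T r' c

  IsSIT⇒RowStandard : ∀ {T} → IsSIT α β T → RowStandard T
  IsSIT⇒RowStandard (shape , perm , rows , _) = shape , perm , rows

  IsSET⇔RowStandard×ColumnsIncrease : ∀ {T} → IsSET α β T ⇔ (RowStandard T × ColumnsIncrease T)
  IsSET⇔RowStandard×ColumnsIncrease = mk⇔
    (λ ((shape , perm , rows , _) , cols) → (shape , perm , rows) , cols)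
    (λ ((shape , perm , rows) , cols) → (shape , perm , rows , cols 0) , cols)

  module _ {T} (std : RowStandard T) where

    RowStandard⇒Unique : Unique (concat T)
    RowStandard⇒Unique = Unique-↭ (↭-sym (proj₁ (proj₂ std))) (Unique-[1…] n)

    entry-∈-rowD : ∀ {r c} → InShape α β r c → entry β T r c ∈ rowD T r
    entry-∈-rowD {r} {c} (r<L , b≤c , c<a) =
      subst (entry β T r c ∈_) (sym (rowD≡map-entry T (proj₁ std) r r<L)) (∈-map⁺ (entry β T r) (∈-colsOf⁺ r c b≤c c<a))

    rowOf-entry : ∀ {r c} → InShape α β r c → rowOf (entry β T r c) T ≡ r
    rowOf-entry inShape = rowOf-∈rowD T _ RowStandard⇒Unique (entry-∈-rowD inShape)

    rowOf-entryAt : ∀ {x} → x ∈ cells → rowOf (entryAt T x) T ≡ proj₁ x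
    rowOf-entryAt {r , c} x∈ = rowOf-entry (∈-cells⁻ x∈)

    ∈-concat : ∀ {k} → 1 ≤ k → k ≤ n → k ∈ concat T
    ∈-concat 1≤k k≤n = ↭.∈-resp-↭ (↭-sym (proj₁ (proj₂ std))) (∈-[1…]⁺ 1≤k k≤n)

    ∈-rowD⇒ : ∀ {k r} → k ∈ rowD T r → (1 ≤ k × k ≤ n) × rowOf k T ≡ r
    ∈-rowD⇒ {k} {r} k∈ =
      ∈-[1…]⁻ (↭.∈-resp-↭ (proj₁ (proj₂ std)) (∈-rowD⇒∈-concat T r k∈)) , rowOf-∈rowD T r RowStandard⇒Unique k∈

    ∑-reindex : ∀ (g : ℕ → ℕ) → ∑ (g ∘ suc) n ≡ ∑ₗ (g ∘ entryAt T) cells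
    ∑-reindex g = begin
      ∑ (g ∘ suc) n                   ≡⟨ sym (sum-map-upTo (g ∘ suc) n) ⟩
      ∑ₗ (g ∘ suc) (upTo n)           ≡⟨ sym (∑ₗ-map g suc (upTo n)) ⟩
      ∑ₗ g [1… n ]                    ≡⟨ sym (∑ₗ-↭ g (proj₁ (proj₂ std))) ⟩
      ∑ₗ g (concat T)                 ≡⟨ cong (∑ₗ g) (concat≡map-entryAt T (proj₁ std)) ⟩
      ∑ₗ g (map (entryAt T) cells)    ≡⟨ ∑ₗ-map g (entryAt T) cells ⟩
      ∑ₗ (g ∘ entryAt T) cells        ∎
      where open ≡-Reasoning

    entryAt-surjective : ∀ {v} → 1 ≤ v → v ≤ n → ∃ λ x → x ∈ cells × v ≡ entryAt T x
    entryAt-surjective 1≤v v≤n =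
      ∈-map⁻ (entryAt T) (subst (_ ∈_) (concat≡map-entryAt T (proj₁ std)) (∈-concat 1≤v v≤n))

    entryAt-range : ∀ {x} → x ∈ cells → 1 ≤ entryAt T x × entryAt T x ≤ n
    entryAt-range x∈ = ∈-[1…]⁻ (↭.∈-resp-↭ (proj₁ (proj₂ std))
      (subst (_ ∈_) (sym (concat≡map-entryAt T (proj₁ std))) (∈-map⁺ (entryAt T) x∈)))

    entryAt-injective : ∀ {x y} → x ∈ cells → y ∈ cells → entryAt T x ≡ entryAt T y → x ≡ y
    entryAt-injective = Unique-map⇒injective (entryAt T) cells
      (subst Unique (concat≡map-entryAt T (proj₁ std)) RowStandard⇒Unique)

    entry-row-< : ∀ {r c c'} → InShape α β r c → InShape α β r c' → c < c' → entry β T r c < entry β T r c'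
    entry-row-< {r} {c} {c'} (r<L , b≤c , _) (_ , _ , c'<a) c<c' =
      lookupD-Linked< (rowD T r) (All.lookup (proj₂ (proj₂ std)) (rowD-∈ T r (subst (r <_) (sym (proj₁ (proj₁ std))) r<L)))
        (c ∸ part β r) (c' ∸ part β r) (∸-monoˡ-< c<c' b≤c)
        (subst (c' ∸ part β r <_) (sym (proj₂ (proj₁ std) r r<L)) (∸-monoˡ-< c'<a (≤-trans b≤c (<⇒≤ c<c'))))

  data StepView (S U : Tab) : Set where
    fixes : U ≡ S → StepView S U
    swaps : ∀ i → 1 ≤ i → suc i ≤ n → U ≡ swapT i S → rowOf (suc i) S < rowOf i S → StepView S U

  step-view : ∀ {S U} → Step n S U → StepView S U
  step-view {S} {U} (i , 1≤i , i<n , πS≡U) with rowOf i S <? rowOf (suc i) S | rowOf (suc i) S <? rowOf i S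
  ... | yes lt | _      rewrite <ᵇ-true lt                  = fixes (sym (just-injective πS≡U))
  ... | no nlt | yes lt rewrite <ᵇ-false nlt | <ᵇ-true lt  = swaps i 1≤i i<n (sym (just-injective πS≡U)) lt
  ... | no nlt | no nlt' rewrite <ᵇ-false nlt | <ᵇ-false nlt' with () ← πS≡U

  π-swapT : ∀ i T → rowOf (suc i) T < rowOf i T → π i T ≡ just (swapT i T)
  π-swapT i T lt rewrite <ᵇ-false (<⇒≯ lt) | <ᵇ-true lt = refl

  inv : Tab → ℕ
  inv T = inversions (λ k → rowOf k T) n

  inv-swapT : ∀ S i → 1 ≤ i → suc i ≤ n → rowOf (suc i) S < rowOf i S → suc (inv (swapT i S)) ≡ inv S
  inv-swapT S (suc j) _ 2+j≤n lt = begin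
    suc (inv (swapT (suc j) S))
      ≡⟨ +-comm 1 _ ⟩
    inv (swapT (suc j) S) + 1
      ≡⟨ cong₂ _+_ (inversions-cong n (λ k _ _ → rowOf-swapT (suc j) k S)) (cong 𝟙 (sym (<ᵇ-true lt))) ⟩
    inversions (w ∘ σ (suc j)) n + 𝟙 (w (suc (suc j)) <ᵇ w (suc j))
      ≡⟨ inversions-σ w j n 2+j≤n ⟩
    inv S + 𝟙 (w (suc j) <ᵇ w (suc (suc j)))
      ≡⟨ cong (λ b → inv S + 𝟙 b) (<ᵇ-false (<⇒≯ lt)) ⟩
    inv S + 0
      ≡⟨ +-identityʳ _ ⟩
    inv S
      ∎
    where
    open ≡-Reasoning
    w : ℕ → ℕ
    w k = rowOf k S

  Step⇒inv : ∀ {S U} → Step n S U → U ≡ S ⊎ suc (inv U) ≡ inv S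
  Step⇒inv {S} {U} step with step-view {S} {U} step
  ... | fixes e                 = inj₁ e
  ... | swaps i 1≤i i<n refl lt = inj₂ (inv-swapT S i 1≤i i<n lt)

  Leq⇒inv : ∀ {S U} → Leq α β S U → U ≡ S ⊎ inv U < inv S
  Leq⇒inv ε = inj₁ refl
  Leq⇒inv {S} (_◅_ {j = M} step steps) with Step⇒inv {S} {M} step | Leq⇒inv steps
  ... | inj₁ refl | r         = r
  ... | inj₂ e    | inj₁ refl = inj₂ (≤-reflexive e)
  ... | inj₂ e    | inj₂ lt   = inj₂ (<-trans lt (≤-reflexive e))

  Leq⇒inv≥ : ∀ {S U} → Leq α β S U → inv U ≤ inv S
  Leq⇒inv≥ S≤U with Leq⇒inv S≤U
  ... | inj₁ refl = ≤-refl
  ... | inj₂ lt   = <⇒≤ lt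

  Leq-antisym : ∀ {S U} → Leq α β S U → Leq α β U S → S ≡ U
  Leq-antisym S≤U U≤S with Leq⇒inv S≤U
  ... | inj₁ e  = sym e
  ... | inj₂ lt = ⊥-elim (<⇒≱ lt (Leq⇒inv≥ U≤S))

  map-σ-[1…] : ∀ i → 1 ≤ i → suc i ≤ n → map (σ i) [1… n ] ↭ [1… n ]
  map-σ-[1…] i 1≤i i<n =
    Unique-⊆-⊇⇒↭ (Unique.map⁺ (σ-injective i) (Unique-[1…] n)) (Unique-[1…] n)
      (λ x x∈ → let (y , y∈ , x≡σy) = ∈-map⁻ (σ i) x∈ in subst (_∈ [1… n ]) (sym x≡σy) (σ-∈ y∈))
      (λ x x∈ → subst (_∈ _) (σ-involutive i x) (∈-map⁺ (σ i) (σ-∈ x∈)))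
    where
    σ-range : ∀ y → 1 ≤ y → y ≤ n → 1 ≤ σ i y × σ i y ≤ n
    σ-range y 1≤y y≤n with σ-view i y
    ... | at-i    _ e   rewrite e = s≤s z≤n , i<n
    ... | at-1+i  _ e   rewrite e = 1≤i , ≤-trans (n≤1+n i) i<n
    ... | outside _ _ e rewrite e = 1≤y , y≤n
    σ-∈ : ∀ {y} → y ∈ [1… n ] → σ i y ∈ [1… n ]
    σ-∈ y∈ = let (1≤y , y≤n) = ∈-[1…]⁻ y∈ ; (1≤σy , σy≤n) = σ-range _ 1≤y y≤n in ∈-[1…]⁺ 1≤σy σy≤n

  Linked-map-σ : ∀ i ρ → Linked _<_ ρ → ¬ (i ∈ ρ × suc i ∈ ρ) → Linked _<_ (map (σ i) ρ)
  Linked-map-σ i []          _         _        = []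
  Linked-map-σ i (x ∷ [])    _         _        = [-]
  Linked-map-σ i (x ∷ y ∷ ρ) (x<y ∷ l) not-both =
    σ-mono-< i x<y (λ (x≡i , y≡1+i) → not-both (here (sym x≡i) , there (here (sym y≡1+i)))) ∷
    Linked-map-σ i (y ∷ ρ) l (λ (i∈ , 1+i∈) → not-both (there i∈ , there 1+i∈))

  swapT-rows : ∀ i (S : Tab) → All (Linked _<_) S → (∀ r → ¬ (i ∈ rowD S r × suc i ∈ rowD S r)) →
               All (Linked _<_) (swapT i S)
  swapT-rows i []      _        _        = []
  swapT-rows i (ρ ∷ S) (l ∷ ls) not-both = Linked-map-σ i ρ l (not-both 0) ∷ swapT-rows i S ls (not-both ∘ suc)

  swapT-RowStandard : ∀ {S} → RowStandard S → ∀ i → 1 ≤ i → suc i ≤ n → rowOf (suc i) S ≢ rowOf i S →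
                      RowStandard (swapT i S)
  swapT-RowStandard {S} std@((lengthS , lengths) , perm , rows) i 1≤i i<n different =
    (trans (length-map (map (σ i)) S) lengthS ,
     λ r r<L → trans (cong length (rowD-map-map (σ i) S r)) (trans (length-map (σ i) (rowD S r)) (lengths r r<L))) ,
    subst (_↭ [1… n ]) (sym (concat-map S)) (↭-trans (↭.map⁺ (σ i) perm) (map-σ-[1…] i 1≤i i<n)) ,
    swapT-rows i S rows (λ r (i∈ , 1+i∈) →
      different (trans (rowOf-∈rowD S r (RowStandard⇒Unique std) 1+i∈) (sym (rowOf-∈rowD S r (RowStandard⇒Unique std) i∈))))

  swapT-ColumnsIncrease : ∀ {S} → RowStandard S → ColumnsIncrease S → ∀ i → 1 ≤ i →
    (∀ c r r' → r < r' → InShape α β r c → InShape α β r' c → ¬ (entry β S r c ≡ i × entry β S r' c ≡ suc i)) →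
    ColumnsIncrease (swapT i S)
  swapT-ColumnsIncrease {S} std cols i 1≤i not-vertical c r r' r<r' inShape inShape' =
    subst₂ _<_ (sym (entry-swapT β i S r c 1≤i)) (sym (entry-swapT β i S r' c 1≤i))
      (σ-mono-< i (cols c r r' r<r' inShape inShape') (not-vertical c r r' r<r' inShape inShape'))

  descent-not-vertical : ∀ {S} → RowStandard S → ∀ i → rowOf (suc i) S < rowOf i S →
    ∀ c r r' → r < r' → InShape α β r c → InShape α β r' c → ¬ (entry β S r c ≡ i × entry β S r' c ≡ suc i)
  descent-not-vertical {S} std i lt c r r' r<r' inShape inShape' (e , e') =
    <-asym lt (subst₂ _<_ (rowOf-at e inShape) (rowOf-at e' inShape') r<r')
    where
    rowOf-at : ∀ {k r c} → entry β S r c ≡ k → InShape α β r c → r ≡ rowOf k S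
    rowOf-at refl inShape = sym (rowOf-entry std inShape)

  IsSET′ : Tab → Set
  IsSET′ T = RowStandard T × ColumnsIncrease T

  Step-IsSET′ : ∀ {S U} → IsSET′ S → Step n S U → IsSET′ U
  Step-IsSET′ {S} {U} (std , cols) step with step-view {S} {U} step
  ... | fixes refl = std , cols
  ... | swaps i 1≤i i<n refl lt =
    swapT-RowStandard std i 1≤i i<n (<⇒≢ lt) , swapT-ColumnsIncrease std cols i 1≤i (descent-not-vertical std i lt)

  Leq-IsSET′ : ∀ {S U} → IsSET′ S → Leq α β S U → IsSET′ U
  Leq-IsSET′ s ε              = s
  Leq-IsSET′ {S} s (_◅_ {j = M} step steps) = Leq-IsSET′ (Step-IsSET′ {S} {M} s step) steps

  Down : Tab → Tab → Set
  Down S U = Step n S U × suc (inv U) ≡ inv S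

  StrictlyBelow : Tab → Tab → Set
  StrictlyBelow S U = Leq α β S U × S ≢ U

  Down⇒StrictlyBelow : ∀ {S U} → Down S U → StrictlyBelow S U
  Down⇒StrictlyBelow (step , invs) = (step ◅ ε) , λ S≡U → 1+n≢n (trans invs (cong inv S≡U))

  Down-IsSET : ∀ {S} Ts → IsSET′ S → Linked Down (S ∷ Ts) → All (IsSET α β) (S ∷ Ts)
  Down-IsSET []       set _           = Equivalence.from IsSET⇔RowStandard×ColumnsIncrease set ∷ []
  Down-IsSET (U ∷ Us) set (down ∷ ds) =
    Equivalence.from IsSET⇔RowStandard×ColumnsIncrease set ∷ Down-IsSET Us (Step-IsSET′ set (proj₁ down)) ds

  StrictlyBelow-chain-length : ∀ T Ts → Linked StrictlyBelow (T ∷ Ts) → length Ts ≤ inv T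
  StrictlyBelow-chain-length T []       _                    = z≤n
  StrictlyBelow-chain-length T (U ∷ Us) ((T≤U , T≢U) ∷ chain) with Leq⇒inv T≤U
  ... | inj₁ U≡T   = ⊥-elim (T≢U (sym U≡T))
  ... | inj₂ invU< = ≤-trans (s≤s (StrictlyBelow-chain-length U Us chain)) invU<

-- Shapes and the row reading

part-⊆c : ∀ {b a} → b ⊆c a → ∀ r → part b r ≤ part a r
part-⊆c []⊆       r       = z≤n
part-⊆c (p ∷⊆ s) zero    = p
part-⊆c (p ∷⊆ s) (suc r) = part-⊆c s r

sum-⊆c : ∀ {b a} → b ⊆c a → sum b ≤ sum a
sum-⊆c []⊆       = z≤n
sum-⊆c (p ∷⊆ s) = +-mono-≤ p (sum-⊆c s)

∑-part : ∀ (a : List ℕ) → ∑ (part a) (length a) ≡ sum a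
∑-part []      = refl
∑-part (x ∷ a) = trans (∑-suc (part (x ∷ a)) (length a)) (cong (x +_) (∑-part a))

∸-+-interchange : ∀ {a b c d} → c ≤ a → d ≤ b → (a ∸ c) + (b ∸ d) ≡ (a + b) ∸ (c + d)
∸-+-interchange {a} {b} {c} {d} c≤a d≤b = sym (begin
  (a + b) ∸ (c + d)   ≡⟨ sym (∸-+-assoc (a + b) c d) ⟩
  (a + b ∸ c) ∸ d     ≡⟨ cong (_∸ d) (+-∸-comm b c≤a) ⟩
  (a ∸ c + b) ∸ d     ≡⟨ +-∸-assoc (a ∸ c) d≤b ⟩
  a ∸ c + (b ∸ d)     ∎)
  where open ≡-Reasoning

∑-part∸part : ∀ {b a} → b ⊆c a → ∑ (λ r → part a r ∸ part b r) (length a) ≡ sum a ∸ sum b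
∑-part∸part {a = a} []⊆ = ∑-part a
∑-part∸part (_∷⊆_ {α = a} p s) =
  trans (∑-suc _ (length a)) (trans (cong (_ +_) (∑-part∸part s)) (∸-+-interchange p (sum-⊆c s)))

part-antitone : ∀ b → IsPartition b → ∀ {r r'} → r ≤ r' → part b r' ≤ part b r
part-antitone []          _       _             = z≤n
part-antitone (x ∷ [])    _       {zero}  {zero}   _ = ≤-refl
part-antitone (x ∷ [])    _       {_}     {suc _}  _ = z≤n
part-antitone (x ∷ y ∷ b) _       {zero}  {zero}   _ = ≤-refl
part-antitone (x ∷ y ∷ b) (x≥y ∷ l) {zero} {suc r'} _ = ≤-trans (part-antitone (y ∷ b) l {zero} {r'} z≤n) x≥y
part-antitone (x ∷ y ∷ b) (_ ∷ l) {suc r} {suc r'} (s≤s r≤r') = part-antitone (y ∷ b) l r≤r'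

applyUpTo-+ : ∀ (f : ℕ → ℕ) a b → applyUpTo f (a + b) ≡ applyUpTo f a ++ applyUpTo (λ x → f (a + x)) b
applyUpTo-+ f zero    b = refl
applyUpTo-+ f (suc a) b = cong (f 0 ∷_) (applyUpTo-+ (f ∘ suc) a b)

concat-rowsFrom : ∀ s ls → concat (rowsFrom s ls) ≡ applyUpTo (λ k → s + suc k) (sum ls)
concat-rowsFrom s []       = refl
concat-rowsFrom s (l ∷ ls) = begin
  map (λ k → s + suc k) (upTo l) ++ concat (rowsFrom (s + l) ls)
    ≡⟨ cong₂ _++_ (map-applyUpTo id _ l) (concat-rowsFrom (s + l) ls) ⟩
  applyUpTo (λ k → s + suc k) l ++ applyUpTo (λ k → s + l + suc k) (sum ls)
    ≡⟨ cong (applyUpTo (λ k → s + suc k) l ++_) (applyUpTo-cong (sum ls)) ⟩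
  applyUpTo (λ k → s + suc k) l ++ applyUpTo (λ x → s + suc (l + x)) (sum ls)
    ≡⟨ sym (applyUpTo-+ (λ k → s + suc k) l (sum ls)) ⟩
  applyUpTo (λ k → s + suc k) (l + sum ls) ∎
  where
  open ≡-Reasoning
  applyUpTo-cong : ∀ m → applyUpTo (λ k → s + l + suc k) m ≡ applyUpTo (λ x → s + suc (l + x)) m
  applyUpTo-cong m = trans (sym (map-applyUpTo id _ m))
    (trans (map-cong (λ k → trans (+-assoc s l (suc k)) (cong (s +_) (+-suc l k))) (upTo m)) (map-applyUpTo id _ m))

length-rowsFrom : ∀ s ls → length (rowsFrom s ls) ≡ length ls
length-rowsFrom s []       = refl
length-rowsFrom s (l ∷ ls) = cong suc (length-rowsFrom (s + l) ls)

rowD-rowsFrom : ∀ s ls r → r < length ls →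
                rowD (rowsFrom s ls) r ≡ map (λ k → s + ∑ (lookupD ls) r + suc k) (upTo (lookupD ls r))
rowD-rowsFrom s (l ∷ ls) zero    _       = map-cong (λ k → cong (_+ suc k) (sym (+-identityʳ s))) (upTo l)
rowD-rowsFrom s (l ∷ ls) (suc r) (s≤s p) = trans (rowD-rowsFrom (s + l) ls r p)
  (map-cong (λ k → cong (_+ suc k) (trans (+-assoc s l _) (cong (s +_) (sym (∑-suc (lookupD (l ∷ ls)) r))))) (upTo (lookupD ls r)))

rowsFrom-bounds : ∀ s ls r x → x ∈ rowD (rowsFrom s ls) r →
                  s + ∑ (lookupD ls) r < x × x ≤ s + ∑ (lookupD ls) (suc r)
rowsFrom-bounds s (l ∷ ls) zero x x∈ with ∈-map⁻ (λ k → s + suc k) x∈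
... | k , k∈ , refl = +-monoʳ-< s z<s , +-monoʳ-≤ s (∈-upTo⁻ k∈)
rowsFrom-bounds s (l ∷ ls) (suc r) x x∈ with rowsFrom-bounds (s + l) ls r x x∈
... | lower , upper = subst (_< x) (shift r) lower , subst (x ≤_) (shift (suc r)) upper
  where
  shift : ∀ r → s + l + ∑ (lookupD ls) r ≡ s + ∑ (lookupD (l ∷ ls)) (suc r)
  shift r = trans (+-assoc s l _) (cong (s +_) (sym (∑-suc (lookupD (l ∷ ls)) r)))

rowsFrom-rows : ∀ s ls → All (Linked _<_) (rowsFrom s ls)
rowsFrom-rows s []       = []
rowsFrom-rows s (l ∷ ls) =
  subst (Linked _<_) (sym (map-applyUpTo id (λ k → s + suc k) l))
    (applyUpTo⁺₂ (λ k → s + suc k) l (λ j → +-monoʳ-< s (n<1+n (suc j)))) ∷ rowsFrom-rows (s + l) ls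

-- The column reading

_≺_ : ℕ × ℕ → ℕ × ℕ → Set
(r' , c') ≺ (r , c) = c' < c ⊎ (c' ≡ c × r' < r)

_≺?_ : ∀ x y → Dec (x ≺ y)
(r' , c') ≺? (r , c) = (c' <? c) ⊎-dec ((c' ≟ c) ×-dec (r' <? r))

_≺ᵇ_ : ℕ × ℕ → ℕ × ℕ → Bool
(r' , c') ≺ᵇ (r , c) = (c' <ᵇ c) ∨ ((c' ≡ᵇ c) ∧ (r' <ᵇ r))

≺ᵇ-true : ∀ {x y} → x ≺ y → (x ≺ᵇ y) ≡ true
≺ᵇ-true {_ , _} {_ , _} = dec-true (_ ≺? _)

≺ᵇ-false : ∀ {x y} → ¬ x ≺ y → (x ≺ᵇ y) ≡ false
≺ᵇ-false {_ , _} {_ , _} = dec-false (_ ≺? _)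

≺ᵇ-true⇒≺ : ∀ {x y} → (x ≺ᵇ y) ≡ true → x ≺ y
≺ᵇ-true⇒≺ {x} {y} e with x ≺? y
... | yes x≺y = x≺y
... | no  x⊀y = contradiction (trans (sym e) (≺ᵇ-false x⊀y)) λ ()

≺-trans : ∀ {x y z} → x ≺ y → y ≺ z → x ≺ z
≺-trans {_ , _} {_ , _} {_ , _} (inj₁ a)          (inj₁ b)          = inj₁ (<-trans a b)
≺-trans {_ , _} {_ , _} {_ , _} (inj₁ a)          (inj₂ (refl , _)) = inj₁ a
≺-trans {_ , _} {_ , _} {_ , _} (inj₂ (refl , _)) (inj₁ b)          = inj₁ b
≺-trans {_ , _} {_ , _} {_ , _} (inj₂ (refl , a)) (inj₂ (refl , b)) = inj₂ (refl , <-trans a b)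

≺-irrefl : ∀ {x} → ¬ x ≺ x
≺-irrefl {_ , _} (inj₁ a)       = <-irrefl refl a
≺-irrefl {_ , _} (inj₂ (_ , a)) = <-irrefl refl a

≺-asym : ∀ {x y} → x ≺ y → ¬ y ≺ x
≺-asym x≺y y≺x = ≺-irrefl (≺-trans x≺y y≺x)

≺-connex : ∀ x y → x ≢ y → x ≺ y ⊎ y ≺ x
≺-connex (r , c) (r' , c') x≢y with <-cmp c c'
... | tri< c<c' _ _ = inj₁ (inj₁ c<c')
... | tri> _ _ c>c' = inj₂ (inj₁ c>c')
... | tri≈ _ refl _ with <-cmp r r'
...   | tri< r<r' _ _ = inj₁ (inj₂ (refl , r<r'))
...   | tri≈ _ refl _ = ⊥-elim (x≢y refl)
...   | tri> _ _ r>r' = inj₂ (inj₂ (refl , r>r'))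

weaklySouthWestᵇ : ℕ × ℕ → ℕ × ℕ → Bool
weaklySouthWestᵇ (rx , cx) (ry , cy) = (rx ≤ᵇ ry) ∧ (cx ≤ᵇ cy)

sameCellᵇ : ℕ × ℕ → ℕ × ℕ → Bool
sameCellᵇ (rx , cx) (ry , cy) = (rx ≡ᵇ ry) ∧ (cx ≡ᵇ cy)

sameCellᵇ-refl : ∀ y → sameCellᵇ y y ≡ true
sameCellᵇ-refl (r , c) rewrite ≡ᵇ-true (refl {x = r}) | ≡ᵇ-true (refl {x = c}) = refl

sameCellᵇ-≢ : ∀ x y → x ≢ y → sameCellᵇ x y ≡ false
sameCellᵇ-≢ (rx , cx) (ry , cy) x≢y with rx ≟ ry | cx ≟ cy
... | yes refl | yes refl = ⊥-elim (x≢y refl)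
... | no  rx≢ry | _       rewrite ≡ᵇ-false rx≢ry = refl
... | yes refl | no cx≢cy rewrite ≡ᵇ-false cx≢cy = ∧-zeroʳ _

weaklySouthWest-sameCell : ∀ x y → (weaklySouthWestᵇ x y ∧ sameCellᵇ x y) ≡ sameCellᵇ x y
weaklySouthWest-sameCell (rx , cx) (ry , cy) with rx ≟ ry | cx ≟ cy
... | yes refl | yes refl  rewrite ≤ᵇ-true (≤-refl {rx}) | ≤ᵇ-true (≤-refl {cx}) = refl
... | no  rx≢ry | _        rewrite ≡ᵇ-false rx≢ry = ∧-zeroʳ _
... | yes refl  | no cx≢cy rewrite ≡ᵇ-false cx≢cy | ∧-zeroʳ (rx ≡ᵇ rx) = ∧-zeroʳ _

≺-not-above≡weaklySouthWest-other : ∀ x y →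
  (x ≺ᵇ y ∧ not (proj₁ y <ᵇ proj₁ x)) ≡ (weaklySouthWestᵇ x y ∧ not (sameCellᵇ x y))
≺-not-above≡weaklySouthWest-other (rx , cx) (ry , cy) with <-cmp cx cy | <-cmp rx ry
... | tri< c< _ _ | tri< r< _ _
  rewrite <ᵇ-true c< | <ᵇ-false (<-asym r<) | ≤ᵇ-true (<⇒≤ r<) | ≤ᵇ-true (<⇒≤ c<) | ≡ᵇ-false (<⇒≢ c<)
        | ∧-zeroʳ (rx ≡ᵇ ry) = refl
... | tri< c< _ _ | tri≈ _ refl _
  rewrite <ᵇ-true c< | <ᵇ-false (<-irrefl {rx} refl) | ≤ᵇ-true (≤-refl {rx}) | ≤ᵇ-true (<⇒≤ c<) | ≡ᵇ-false (<⇒≢ c<)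
        | ∧-zeroʳ (rx ≡ᵇ rx) = refl
... | tri< c< _ _ | tri> _ _ r>
  rewrite <ᵇ-true c< | <ᵇ-true r> | ≤ᵇ-false (<⇒≱ r>) = refl
... | tri≈ _ refl _ | tri< r< _ _
  rewrite <ᵇ-false (<-irrefl {cx} refl) | ≡ᵇ-true (refl {x = cx}) | <ᵇ-true r< | <ᵇ-false (<-asym r<) | ≤ᵇ-true (<⇒≤ r<)
        | ≤ᵇ-true (≤-refl {cx}) | ≡ᵇ-false (<⇒≢ r<) = refl
... | tri≈ _ refl _ | tri≈ _ refl _
  rewrite <ᵇ-false (<-irrefl {cx} refl) | ≡ᵇ-true (refl {x = cx}) | <ᵇ-false (<-irrefl {rx} refl)
        | ≤ᵇ-true (≤-refl {rx}) | ≤ᵇ-true (≤-refl {cx}) | ≡ᵇ-true (refl {x = rx}) = refl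
... | tri≈ _ refl _ | tri> _ _ r>
  rewrite <ᵇ-false (<-irrefl {cx} refl) | ≡ᵇ-true (refl {x = cx}) | <ᵇ-false (<-asym r>) | ≤ᵇ-false (<⇒≱ r>) = refl
... | tri> _ _ c> | _
  rewrite <ᵇ-false (<-asym c>) | ≡ᵇ-false (λ e → <-irrefl (sym e) c>) | ≤ᵇ-false (<⇒≱ c>) | ∧-zeroʳ (rx ≤ᵇ ry) = refl

∑𝟙-∧ˡ : ∀ d (b : ℕ → Bool) m → ∑ (λ j → 𝟙 (d ∧ b j)) m ≡ (if d then ∑ (𝟙 ∘ b) m else 0)
∑𝟙-∧ˡ true  b m = refl
∑𝟙-∧ˡ false b m = ∑-zero m (λ _ _ → refl)

∑ₗ-sameCell : ∀ xs y → Unique xs → y ∈ xs → ∑ₗ (λ x → 𝟙 (sameCellᵇ x y)) xs ≡ 1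
∑ₗ-sameCell (z ∷ zs) y (z∉ ∷ _) (here refl) rewrite sameCellᵇ-refl y =
  cong suc (∑ₗ-zero _ zs (λ w w∈ → cong 𝟙 (sameCellᵇ-≢ w y (λ e → All.lookup z∉ w∈ (sym e)))))
∑ₗ-sameCell (z ∷ zs) y (z∉ ∷ u) (there y∈) rewrite sameCellᵇ-≢ z y (All.lookup z∉ y∈) = ∑ₗ-sameCell zs y u y∈

module Skew (α β : List ℕ) (β⊆α : β ⊆c α) where

  open Tableaux α β

  ∑-len : ∑ len L ≡ n
  ∑-len = ∑-part∸part β⊆α

  Srow-RowStandard : RowStandard (Srow α β)
  Srow-RowStandard =
    (trans (length-rowsFrom 0 lens) length-lens ,
     λ r r<L → trans (cong length (rowD-rowsFrom 0 lens r (subst (r <_) (sym length-lens) r<L)))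
                     (trans (length-map-upTo _ (lookupD lens r)) (lookupD-map-upTo len L r r<L))) ,
    subst (_↭ [1… n ]) (sym (trans (concat-rowsFrom 0 lens) (cong (applyUpTo suc) sum-lens)))
      (subst (applyUpTo suc n ↭_) (sym (map-applyUpTo id suc n)) ↭-refl) ,
    rowsFrom-rows 0 lens
    where
    lens : List ℕ
    lens = rowLens α β
    length-lens : length lens ≡ L
    length-lens = length-map-upTo len L
    sum-lens : sum lens ≡ n
    sum-lens = trans (sum-map-upTo len L) ∑-len

  RowMonotone : Tab → Set
  RowMonotone T = ∀ a b → 1 ≤ a → a ≤ b → b ≤ n → rowOf a T ≤ rowOf b T

  Srow-RowMonotone : RowMonotone (Srow α β)
  Srow-RowMonotone a b 1≤a a≤b b≤n with rowOf a (Srow α β) ≤? rowOf b (Srow α β)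
  ... | yes ra≤rb = ra≤rb
  ... | no  ra≰rb = ⊥-elim (<⇒≱ b<a a≤b)
    where
    S : Tab
    S = Srow α β
    P : ℕ → ℕ
    P = ∑ (lookupD (rowLens α β))
    bounds : ∀ {k} → 1 ≤ k → k ≤ n → P (rowOf k S) < k × k ≤ P (suc (rowOf k S))
    bounds {k} 1≤k k≤n =
      rowsFrom-bounds 0 (rowLens α β) (rowOf k S) k (∈-rowD-rowOf S (∈-concat Srow-RowStandard 1≤k k≤n))
    b<a : b < a
    b<a = ≤-<-trans (proj₂ (bounds (≤-trans 1≤a a≤b) b≤n))
            (≤-<-trans (∑-mono-bound (lookupD (rowLens α β)) (≰⇒> ra≰rb)) (proj₁ (bounds 1≤a (≤-trans a≤b b≤n))))

  rowOf-ext : ∀ {T U} → RowStandard T → RowStandard U → (∀ k → 1 ≤ k → k ≤ n → rowOf k T ≡ rowOf k U) → T ≡ U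
  rowOf-ext {T} {U} stdT@((lengthT , _) , _ , rowsT) stdU@((lengthU , _) , _ , rowsU) same =
    trans (≡-map-rowD T lengthT) (trans (map-cong-local (All.tabulate rows)) (sym (≡-map-rowD U lengthU)))
    where
    rows : ∀ {r} → r ∈ upTo L → rowD T r ≡ rowD U r
    rows {r} r∈ = Linked<-≡ (rowD T r) (rowD U r)
      (All.lookup rowsT (rowD-∈ T r (subst (r <_) (sym lengthT) (∈-upTo⁻ r∈))))
      (All.lookup rowsU (rowD-∈ U r (subst (r <_) (sym lengthU) (∈-upTo⁻ r∈))))
      (λ k k∈ → let ((1≤k , k≤n) , e) = ∈-rowD⇒ stdT k∈ in
        subst (λ z → k ∈ rowD U z) (trans (sym (same k 1≤k k≤n)) e) (∈-rowD-rowOf U (∈-concat stdU 1≤k k≤n)))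
      (λ k k∈ → let ((1≤k , k≤n) , e) = ∈-rowD⇒ stdU k∈ in
        subst (λ z → k ∈ rowD T z) (trans (same k 1≤k k≤n) e) (∈-rowD-rowOf T (∈-concat stdT 1≤k k≤n)))

  valuesUpToRow : Tab → ℕ → ℕ
  valuesUpToRow T r = ∑ (λ k → 𝟙 (rowOf (suc k) T ≤ᵇ r)) n

  valuesUpToRow-cells : ∀ {T} → RowStandard T → ∀ r → valuesUpToRow T r ≡ ∑ₗ (λ x → 𝟙 (proj₁ x ≤ᵇ r)) cells
  valuesUpToRow-cells {T} std r = trans (∑-reindex std (λ k → 𝟙 (rowOf k T ≤ᵇ r)))
    (∑ₗ-cong cells (λ x x∈ → cong (λ z → 𝟙 (z ≤ᵇ r)) (rowOf-entryAt std x∈)))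

  RowMonotone⇒≤valuesUpToRow : ∀ {T} → RowMonotone T → ∀ k r → 1 ≤ k → k ≤ n → rowOf k T ≤ r → k ≤ valuesUpToRow T r
  RowMonotone⇒≤valuesUpToRow {T} mono k r 1≤k k≤n ≤r = begin
    k                                      ≡⟨ sym (trans (∑-const 1 k) (*-identityʳ k)) ⟩
    ∑ (λ _ → 1) k
      ≡⟨ sym (∑-cong k (λ j j<k → cong 𝟙 (≤ᵇ-true (≤-trans (mono (suc j) k (s≤s z≤n) j<k k≤n) ≤r)))) ⟩
    ∑ (λ j → 𝟙 (rowOf (suc j) T ≤ᵇ r)) k   ≤⟨ ∑-mono-bound _ k≤n ⟩
    valuesUpToRow T r                      ∎
    where open ≤-Reasoning

  RowMonotone⇒valuesUpToRow< : ∀ {T} → RowMonotone T → ∀ k r → 1 ≤ k → k ≤ n → r < rowOf k T → valuesUpToRow T r < k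
  RowMonotone⇒valuesUpToRow< {T} mono (suc k) r _ k<n r< = begin-strict
    valuesUpToRow T r                          ≡⟨ cong (∑ f) (sym (m+[n∸m]≡n k≤n)) ⟩
    ∑ f (k + (n ∸ k))                          ≡⟨ ∑-split f k (n ∸ k) ⟩
    ∑ f k + ∑ (λ x → f (k + x)) (n ∸ k)        ≡⟨ cong (∑ f k +_) (∑-zero (n ∸ k) beyond) ⟩
    ∑ f k + 0                                  ≡⟨ +-identityʳ _ ⟩
    ∑ f k                                      ≤⟨ ∑𝟙≤ _ k ⟩
    k                                          <⟨ n<1+n k ⟩
    suc k                                      ∎
    where
    open ≤-Reasoning
    k≤n : k ≤ n
    k≤n = ≤-trans (n≤1+n k) k<n
    f : ℕ → ℕ
    f j = 𝟙 (rowOf (suc j) T ≤ᵇ r)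
    beyond : ∀ x → x < n ∸ k → f (k + x) ≡ 0
    beyond x x< = cong 𝟙 (≤ᵇ-false (λ ≤r → <⇒≱ r< (≤-trans (mono (suc k) (suc (k + x)) (s≤s z≤n) (s≤s (m≤m+n k x))
      (subst (suc (k + x) ≤_) (m+[n∸m]≡n k≤n) (+-monoʳ-< k x<))) ≤r)))

  -- In a row-monotone tableau rowOf k is the least r with k ≤ valuesUpToRow T r, and valuesUpToRow does not depend on T.
  RowMonotone-rowOf : ∀ {T U} → RowStandard T → RowStandard U → RowMonotone T → RowMonotone U →
                      ∀ k → 1 ≤ k → k ≤ n → rowOf k T ≡ rowOf k U
  RowMonotone-rowOf {T} {U} stdT stdU monoT monoU k 1≤k k≤n with <-cmp (rowOf k T) (rowOf k U)
  ... | tri≈ _ e _ = e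
  ... | tri< lt _ _ = ⊥-elim (<⇒≱ (RowMonotone⇒valuesUpToRow< {U} monoU k _ 1≤k k≤n lt)
          (subst (k ≤_) (same-count (rowOf k T)) (RowMonotone⇒≤valuesUpToRow {T} monoT k _ 1≤k k≤n ≤-refl)))
    where
    same-count : ∀ r → valuesUpToRow T r ≡ valuesUpToRow U r
    same-count r = trans (valuesUpToRow-cells stdT r) (sym (valuesUpToRow-cells stdU r))
  ... | tri> _ _ gt = ⊥-elim (<⇒≱ (RowMonotone⇒valuesUpToRow< {T} monoT k _ 1≤k k≤n gt)
          (subst (k ≤_) (same-count (rowOf k U)) (RowMonotone⇒≤valuesUpToRow {U} monoU k _ 1≤k k≤n ≤-refl)))
    where
    same-count : ∀ r → valuesUpToRow U r ≡ valuesUpToRow T r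
    same-count r = trans (valuesUpToRow-cells stdU r) (sym (valuesUpToRow-cells stdT r))

  RowMonotone⇒≡Srow : ∀ {T} → RowStandard T → RowMonotone T → T ≡ Srow α β
  RowMonotone⇒≡Srow std mono =
    rowOf-ext std Srow-RowStandard (RowMonotone-rowOf std Srow-RowStandard mono Srow-RowMonotone)

  Ascending⇒RowMonotone : ∀ {T} → (∀ i → 1 ≤ i → suc i ≤ n → rowOf i T ≤ rowOf (suc i) T) → RowMonotone T
  Ascending⇒RowMonotone {T} asc a b 1≤a a≤b b≤n = go (b ∸ a) b (m∸n+n≡m a≤b) b≤n
    where
    go : ∀ d b → d + a ≡ b → b ≤ n → rowOf a T ≤ rowOf b T
    go zero    b refl _   = ≤-refl
    go (suc d) b refl b≤n =
      ≤-trans (go d (d + a) refl (≤-trans (n≤1+n _) b≤n)) (asc (d + a) (≤-trans 1≤a (m≤n+m a d)) b≤n)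

  Descent : Tab → ℕ → Set
  Descent T i = 1 ≤ i × rowOf (suc i) T < rowOf i T

  descent-or-monotone : ∀ T → (∃ λ i → i < n × Descent T i) ⊎ RowMonotone T
  descent-or-monotone T with anyUpTo? (λ i → (1 ≤? i) ×-dec (rowOf (suc i) T <? rowOf i T)) n
  ... | yes d = inj₁ d
  ... | no ¬d = inj₂ (Ascending⇒RowMonotone {T} (λ i 1≤i i<n → ≮⇒≥ (λ lt → ¬d (i , i<n , 1≤i , lt))))

  -- bubble sort of the row word
  sort : ∀ k T → inv T ≡ k → RowStandard T →
         ∃ λ Ts → Linked Down (T ∷ Ts) × length Ts ≡ k × Leq α β T (Srow α β)
  sort k T invT≡k std with descent-or-monotone T
  ... | inj₂ mono = [] , [-] , trans (sym no-inversions) invT≡k , subst (Leq α β T) (RowMonotone⇒≡Srow std mono) ε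
    where
    no-inversions : inv T ≡ 0
    no-inversions = inversions-monotone (λ k → rowOf k T) n (λ a b a<b b<n → mono (suc a) (suc b) z<s (s≤s (<⇒≤ a<b)) b<n)
  ... | inj₁ (i , i<n , 1≤i , lt) with k | inv-swapT T i 1≤i i<n lt
  ...   | zero  | e = ⊥-elim (1+n≢0 (trans e invT≡k))
  ...   | suc k | e with sort k (swapT i T) (suc-injective (trans e invT≡k)) (swapT-RowStandard std i 1≤i i<n (<⇒≢ lt))
  ...     | Ts , down , length≡k , toSrow =
    swapT i T ∷ Ts , (step , e) ∷ down , cong suc length≡k , step ◅ toSrow
    where
    step : Step n T (swapT i T)
    step = i , 1≤i , i<n , π-swapT i T lt

  Leq-Srow : ∀ {T} → RowStandard T → Leq α β T (Srow α β)
  Leq-Srow {T} std = proj₂ (proj₂ (proj₂ (sort (inv T) T refl std)))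

  length-cells : length cells ≡ n
  length-cells = begin
    length cells                            ≡⟨ sym (length-map (entryAt S) cells) ⟩
    length (map (entryAt S) cells)          ≡⟨ cong length (sym (concat≡map-entryAt S (proj₁ Srow-RowStandard))) ⟩
    length (concat S)                       ≡⟨ ↭.↭-length (proj₁ (proj₂ Srow-RowStandard)) ⟩
    length [1… n ]                          ≡⟨ length-map-upTo suc n ⟩
    n                                       ∎
    where
    open ≡-Reasoning
    S : Tab
    S = Srow α β

  Unique-cells : Unique cells
  Unique-cells = Unique.map⁻ (subst Unique (concat≡map-entryAt (Srow α β) (proj₁ Srow-RowStandard))
                                           (RowStandard⇒Unique Srow-RowStandard))

  rank : ℕ × ℕ → ℕ
  rank x = suc (∑ₗ (λ y → 𝟙 (y ≺ᵇ x)) cells)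

  inShapeᵇ-row : ∀ r c → r < L → inShapeᵇ α β r c ≡ ((part β r ≤ᵇ c) ∧ (c <ᵇ part α r))
  inShapeᵇ-row r c r<L rewrite <ᵇ-true r<L = refl

  cellsBefore : ℕ → ℕ → ℕ
  cellsBefore c r' = (c ⊓ part α r') ∸ part β r'

  sum-colCount : ∀ c → sum (map (colCount α β) (upTo c)) ≡ ∑ (cellsBefore c) L
  sum-colCount c = begin
    sum (map (colCount α β) (upTo c))
      ≡⟨ sum-map-upTo _ c ⟩
    ∑ (colCount α β) c
      ≡⟨ ∑-cong c (λ c' _ → count-upTo (λ r' → inShapeᵇ α β r' c') L) ⟩
    ∑ (λ c' → ∑ (λ r' → 𝟙 (inShapeᵇ α β r' c')) L) c
      ≡⟨ ∑-comm (λ c' r' → 𝟙 (inShapeᵇ α β r' c')) c L ⟩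
    ∑ (λ r' → ∑ (λ c' → 𝟙 (inShapeᵇ α β r' c')) c) L
      ≡⟨ ∑-cong L (λ r' r'<L → trans (∑-cong c (λ c' _ → cong 𝟙 (inShapeᵇ-row r' c' r'<L)))
                                     (∑𝟙-interval (part β r') (part α r') c)) ⟩
    ∑ (cellsBefore c) L
      ∎
    where open ≡-Reasoning

  cellsBefore-row : ∀ c r' → ∑ (λ j → 𝟙 (part β r' + j <ᵇ c)) (len r') ≡ cellsBefore c r'
  cellsBefore-row c r' = trans (∑𝟙-shifted-< (part β r') c (len r'))
    (trans (⊓-comm (len r') (c ∸ part β r')) (sym (∸-distribʳ-⊓ (part β r') c (part α r'))))

  cellsBelow-column : ∀ r c → r ≤ L →
    ∑ (λ r' → ∑ (λ j → 𝟙 ((part β r' + j ≡ᵇ c) ∧ (r' <ᵇ r))) (len r')) L ≡ ∑ (λ r' → 𝟙 (inShapeᵇ α β r' c)) r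
  cellsBelow-column r c r≤L = begin
    ∑ (λ r' → ∑ (λ j → 𝟙 ((part β r' + j ≡ᵇ c) ∧ (r' <ᵇ r))) (len r')) L
      ≡⟨ ∑-cong L (λ r' _ → trans (∑𝟙-shifted-≡ (part β r') c (len r') (r' <ᵇ r))
                                  (trans (cong 𝟙 (row-bound r')) (𝟙-∧ (inRow r') (r' <ᵇ r)))) ⟩
    ∑ (λ r' → if r' <ᵇ r then 𝟙 (inRow r') else 0) L
      ≡⟨ ∑-restrict (𝟙 ∘ inRow) r L r≤L ⟩
    ∑ (𝟙 ∘ inRow) r
      ≡⟨ ∑-cong r (λ r' r'<r → cong 𝟙 (sym (inShapeᵇ-row r' c (<-≤-trans r'<r r≤L)))) ⟩
    ∑ (λ r' → 𝟙 (inShapeᵇ α β r' c)) r ∎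
    where
    open ≡-Reasoning
    inRow : ℕ → Bool
    inRow r' = (part β r' ≤ᵇ c) ∧ (c <ᵇ part α r')
    row-bound : ∀ r' → ((part β r' ≤ᵇ c) ∧ ((c <ᵇ part β r' + len r') ∧ (r' <ᵇ r))) ≡ (inRow r' ∧ (r' <ᵇ r))
    row-bound r' = trans (cong (λ z → (part β r' ≤ᵇ c) ∧ ((c <ᵇ z) ∧ (r' <ᵇ r))) (m+[n∸m]≡n (part-⊆c β⊆α r')))
                         (sym (∧-assoc (part β r' ≤ᵇ c) (c <ᵇ part α r') (r' <ᵇ r)))

  𝟙-<ᵇ-∨-≡ᵇ : ∀ x c D → 𝟙 ((x <ᵇ c) ∨ ((x ≡ᵇ c) ∧ D)) ≡ 𝟙 (x <ᵇ c) + 𝟙 ((x ≡ᵇ c) ∧ D)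
  𝟙-<ᵇ-∨-≡ᵇ x c D with x <? c
  ... | yes x<c rewrite <ᵇ-true x<c | ≡ᵇ-false (<⇒≢ x<c) = refl
  ... | no  x≮c rewrite <ᵇ-false x≮c = refl

  cells≺ : ∀ r c → r ≤ L →
           ∑ₗ (λ y → 𝟙 (y ≺ᵇ (r , c))) cells ≡ ∑ (cellsBefore c) L + ∑ (λ r' → 𝟙 (inShapeᵇ α β r' c)) r
  cells≺ r c r≤L = begin
    ∑ₗ (λ y → 𝟙 (y ≺ᵇ (r , c))) cells
      ≡⟨ ∑ₗ-cells _ ⟩
    ∑ (λ r' → ∑ (λ j → 𝟙 ((r' , part β r' + j) ≺ᵇ (r , c))) (len r')) L
      ≡⟨ ∑-cong L (λ r' _ → trans (∑-cong (len r') (λ j _ → 𝟙-<ᵇ-∨-≡ᵇ (part β r' + j) c (r' <ᵇ r)))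
                                  (∑-distrib-+ _ _ (len r'))) ⟩
    ∑ (λ r' → earlier r' + below r') L
      ≡⟨ ∑-distrib-+ earlier below L ⟩
    ∑ earlier L + ∑ below L
      ≡⟨ cong₂ _+_ (∑-cong L (λ r' _ → cellsBefore-row c r')) (cellsBelow-column r c r≤L) ⟩
    ∑ (cellsBefore c) L + ∑ (λ r' → 𝟙 (inShapeᵇ α β r' c)) r ∎
    where
    open ≡-Reasoning
    earlier below : ℕ → ℕ
    earlier r' = ∑ (λ j → 𝟙 (part β r' + j <ᵇ c)) (len r')
    below   r' = ∑ (λ j → 𝟙 ((part β r' + j ≡ᵇ c) ∧ (r' <ᵇ r))) (len r')

  colIndex≡rank : ∀ r c → r < L → colIndex α β r c ≡ rank (r , c)
  colIndex≡rank r c r<L = begin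
    sum (map (colCount α β) (upTo c)) + count (λ r' → inShapeᵇ α β r' c) (upTo r) + 1
      ≡⟨ cong₂ (λ u v → u + v + 1) (sum-colCount c) (count-upTo (λ r' → inShapeᵇ α β r' c) r) ⟩
    ∑ (cellsBefore c) L + ∑ (λ r' → 𝟙 (inShapeᵇ α β r' c)) r + 1
      ≡⟨ +-comm _ 1 ⟩
    suc (∑ (cellsBefore c) L + ∑ (λ r' → 𝟙 (inShapeᵇ α β r' c)) r)
      ≡⟨ cong suc (sym (cells≺ r c (<⇒≤ r<L))) ⟩
    rank (r , c) ∎
    where open ≡-Reasoning

  rank-mono : ∀ {x y} → x ∈ cells → x ≺ y → rank x < rank y
  rank-mono {x} {y} x∈ x≺y = s≤s (∑ₗ-mono-< cells
    (λ z _ → 𝟙-mono (λ z≺x → ≺ᵇ-true (≺-trans (≺ᵇ-true⇒≺ z≺x) x≺y))) x∈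
    (subst₂ _<_ (cong 𝟙 (sym (≺ᵇ-false {x} {x} ≺-irrefl))) (cong 𝟙 (sym (≺ᵇ-true x≺y))) z<s))

  rank≤n : ∀ {x} → x ∈ cells → rank x ≤ n
  rank≤n {x} x∈ = subst (rank x ≤_) length-cells (∑ₗ𝟙<length (_≺ᵇ x) cells x∈ (≺ᵇ-false {x} {x} ≺-irrefl))

  rank-injective : ∀ {x y} → x ∈ cells → y ∈ cells → rank x ≡ rank y → x ≡ y
  rank-injective {x} {y} x∈ y∈ e with ≡-dec _≟_ _≟_ x y
  ... | yes x≡y = x≡y
  ... | no  x≢y with ≺-connex x y x≢y
  ...   | inj₁ x≺y = ⊥-elim (<-irrefl e (rank-mono x∈ x≺y))
  ...   | inj₂ y≺x = ⊥-elim (<-irrefl (sym e) (rank-mono y∈ y≺x))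

  rank-<ᵇ : ∀ {x y} → x ∈ cells → y ∈ cells → (rank x <ᵇ rank y) ≡ (x ≺ᵇ y)
  rank-<ᵇ {x} {y} x∈ y∈ with ≡-dec _≟_ _≟_ x y
  ... | yes refl = trans (<ᵇ-false {rank x} {rank x} (<-irrefl refl)) (sym (≺ᵇ-false {x} {x} ≺-irrefl))
  ... | no  x≢y with ≺-connex x y x≢y
  ...   | inj₁ x≺y = trans (<ᵇ-true (rank-mono x∈ x≺y)) (sym (≺ᵇ-true x≺y))
  ...   | inj₂ y≺x = trans (<ᵇ-false (<-asym (rank-mono y∈ y≺x))) (sym (≺ᵇ-false (≺-asym y≺x)))

  map-rank-cells : map rank cells ↭ [1… n ]
  map-rank-cells = Unique-⊆-⊇⇒↭ ranks-unique (Unique-[1…] n) ranks-⊆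
    (Unique-⊆-length≥⇒⊇ ranks-unique ranks-⊆ (≤-reflexive (trans (length-map-upTo suc n)
      (sym (trans (length-map rank cells) length-cells)))))
    where
    ranks-unique : Unique (map rank cells)
    ranks-unique = map-Unique rank cells Unique-cells (λ x y → rank-injective)
    ranks-⊆ : ∀ v → v ∈ map rank cells → v ∈ [1… n ]
    ranks-⊆ v v∈ with ∈-map⁻ rank v∈
    ... | x , x∈ , refl = ∈-[1…]⁺ (s≤s z≤n) (rank≤n x∈)

  rowD-Scol : ∀ r → r < L → rowD (Scol α β) r ≡ map (colIndex α β r) (colsOf α β r)
  rowD-Scol = rowD-map-upTo (λ r → map (colIndex α β r) (colsOf α β r)) L

  Scol-HasShape : HasShape α β (Scol α β)
  Scol-HasShape = length-map-upTo _ L , λ r r<L → trans (cong length (rowD-Scol r r<L))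
    (trans (length-map (colIndex α β r) (colsOf α β r)) (length-map-upTo (part β r +_) (len r)))

  entry-Scol : ∀ {r c} → InShape α β r c → entry β (Scol α β) r c ≡ rank (r , c)
  entry-Scol {r} {c} (r<L , b≤c , c<a) = begin
    lookupD (rowD (Scol α β) r) (c ∸ part β r)
      ≡⟨ cong (λ l → lookupD l (c ∸ part β r)) (trans (rowD-Scol r r<L) (sym (map-∘ (upTo (len r))))) ⟩
    lookupD (map (colIndex α β r ∘ (part β r +_)) (upTo (len r))) (c ∸ part β r)
      ≡⟨ lookupD-map-upTo _ (len r) (c ∸ part β r) (∸-monoˡ-< c<a b≤c) ⟩
    colIndex α β r (part β r + (c ∸ part β r))
      ≡⟨ cong (colIndex α β r) (m+[n∸m]≡n b≤c) ⟩
    colIndex α β r c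
      ≡⟨ colIndex≡rank r c r<L ⟩
    rank (r , c) ∎
    where open ≡-Reasoning

  entryAt-Scol : ∀ {x} → x ∈ cells → entryAt (Scol α β) x ≡ rank x
  entryAt-Scol {r , c} x∈ = entry-Scol (∈-cells⁻ x∈)

  Scol-rows : All (Linked _<_) (Scol α β)
  Scol-rows = All.tabulate row
    where
    row : ∀ {ρ} → ρ ∈ Scol α β → Linked _<_ ρ
    row ρ∈ with ∈-map⁻ (λ r → map (colIndex α β r) (colsOf α β r)) ρ∈
    ... | r , r∈ , refl =
      subst (Linked _<_) (trans (sym (map-applyUpTo id _ (len r))) (map-∘ (upTo (len r))))
        (applyUpTo⁺₁ (λ j → colIndex α β r (part β r + j)) (len r) (λ {j} 1+j<len → subst₂ _<_
          (sym (colIndex≡rank r _ r<L)) (sym (colIndex≡rank r _ r<L))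
          (rank-mono {y = r , part β r + suc j} (∈-cells⁺ (inShape j (<-trans (n<1+n j) 1+j<len))) (inj₁ (+-monoʳ-< (part β r) (n<1+n j))))))
      where
      r<L : r < L
      r<L = ∈-upTo⁻ r∈
      inShape : ∀ j → j < len r → InShape α β r (part β r + j)
      inShape j j<len = r<L , m≤m+n _ j , <∸⇒+< (part β r) (part α r) j j<len

  Scol-RowStandard : RowStandard (Scol α β)
  Scol-RowStandard = Scol-HasShape ,
    subst (_↭ [1… n ]) (sym (trans (concat≡map-entryAt (Scol α β) Scol-HasShape)
                                   (map-cong-local (All.tabulate (λ {x} → entryAt-Scol {x}))))) map-rank-cells ,
    Scol-rows

  Scol-ColumnsIncrease : ColumnsIncrease (Scol α β)
  Scol-ColumnsIncrease c r r' r<r' inShape inShape' rewrite entry-Scol inShape | entry-Scol inShape' =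
    rank-mono {y = r' , c} (∈-cells⁺ inShape) (inj₂ (refl , r<r'))

  Scol-IsSET′ : IsSET′ (Scol α β)
  Scol-IsSET′ = Scol-RowStandard , Scol-ColumnsIncrease

  inv-cells : ∀ {T} → RowStandard T →
    inv T ≡ ∑ₗ (λ y → ∑ₗ (λ x → 𝟙 ((entryAt T x <ᵇ entryAt T y) ∧ (proj₁ y <ᵇ proj₁ x))) cells) cells
  inv-cells {T} std =
    trans (∑-reindex std (λ B → ∑ (λ a → 𝟙 ((suc a <ᵇ B) ∧ (rowOf B T <ᵇ rowOf (suc a) T))) n))
          (∑ₗ-cong cells (λ y y∈ → trans (∑-reindex std (λ A → 𝟙 ((A <ᵇ entryAt T y) ∧ (rowOf (entryAt T y) T <ᵇ rowOf A T))))
            (∑ₗ-cong cells (λ x x∈ → cong₂ (λ u v → 𝟙 ((entryAt T x <ᵇ entryAt T y) ∧ (u <ᵇ v)))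
              (rowOf-entryAt std y∈) (rowOf-entryAt std x∈)))))

  inv-Scol-cells : inv (Scol α β) ≡ ∑ₗ (λ y → ∑ₗ (λ x → 𝟙 ((x ≺ᵇ y) ∧ (proj₁ y <ᵇ proj₁ x))) cells) cells
  inv-Scol-cells = trans (inv-cells Scol-RowStandard) (∑ₗ-cong cells (λ y y∈ → ∑ₗ-cong cells (λ x x∈ →
    cong (λ z → 𝟙 (z ∧ (proj₁ y <ᵇ proj₁ x))) (trans (cong₂ _<ᵇ_ (entryAt-Scol x∈) (entryAt-Scol y∈)) (rank-<ᵇ x∈ y∈)))))

  C2-cells : n C 2 ≡ ∑ₗ (λ y → ∑ₗ (λ x → 𝟙 (x ≺ᵇ y)) cells) cells
  C2-cells = begin
    n C 2                                                        ≡⟨ sym (pairs≡C2 n) ⟩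
    ∑ (λ b → ∑ (λ a → 𝟙 (a <ᵇ b)) n) n
      ≡⟨ ∑-reindex Scol-RowStandard (λ B → ∑ (λ a → 𝟙 (suc a <ᵇ B)) n) ⟩
    ∑ₗ (λ y → ∑ (λ a → 𝟙 (suc a <ᵇ entryAt S y)) n) cells
      ≡⟨ ∑ₗ-cong cells (λ y y∈ → ∑-reindex Scol-RowStandard (λ A → 𝟙 (A <ᵇ entryAt S y))) ⟩
    ∑ₗ (λ y → ∑ₗ (λ x → 𝟙 (entryAt S x <ᵇ entryAt S y)) cells) cells
      ≡⟨ ∑ₗ-cong cells (λ y y∈ → ∑ₗ-cong cells (λ x x∈ →
           cong 𝟙 (trans (cong₂ _<ᵇ_ (entryAt-Scol x∈) (entryAt-Scol y∈)) (rank-<ᵇ x∈ y∈)))) ⟩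
    ∑ₗ (λ y → ∑ₗ (λ x → 𝟙 (x ≺ᵇ y)) cells) cells                 ∎
    where
    open ≡-Reasoning
    S : Tab
    S = Scol α β

  weaklySouthWest-count : ∀ r c → r < L →
    ∑ₗ (λ x → 𝟙 (weaklySouthWestᵇ x (r , c))) cells
    ≡ sum (map (λ r' → count (λ c' → inShapeᵇ α β r' c') (upTo (suc c))) (upTo (suc r)))
  weaklySouthWest-count r c r<L = begin
    ∑ₗ (λ x → 𝟙 (weaklySouthWestᵇ x (r , c))) cells
      ≡⟨ ∑ₗ-cells _ ⟩
    ∑ (λ r' → ∑ (λ j → 𝟙 ((r' ≤ᵇ r) ∧ (part β r' + j ≤ᵇ c))) (len r')) L
      ≡⟨ ∑-cong L (λ r' _ → trans (∑𝟙-∧ˡ (r' ≤ᵇ r) (λ j → part β r' + j ≤ᵇ c) (len r'))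
                                  (cong (λ z → if z then inRowUpTo r' else 0) (≤ᵇ-<ᵇ r' r))) ⟩
    ∑ (λ r' → if r' <ᵇ suc r then inRowUpTo r' else 0) L
      ≡⟨ ∑-restrict inRowUpTo (suc r) L r<L ⟩
    ∑ inRowUpTo (suc r)
      ≡⟨ ∑-cong (suc r) (λ r' r'<1+r → inRowUpTo≡count r' (≤-<-trans (≤-pred r'<1+r) r<L)) ⟩
    ∑ (λ r' → count (λ c' → inShapeᵇ α β r' c') (upTo (suc c))) (suc r)
      ≡⟨ sym (sum-map-upTo _ (suc r)) ⟩
    sum (map (λ r' → count (λ c' → inShapeᵇ α β r' c') (upTo (suc c))) (upTo (suc r))) ∎
    where
    open ≡-Reasoning
    inRowUpTo : ℕ → ℕ
    inRowUpTo r' = ∑ (λ j → 𝟙 (part β r' + j ≤ᵇ c)) (len r')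
    inRowUpTo≡count : ∀ r' → r' < L → inRowUpTo r' ≡ count (λ c' → inShapeᵇ α β r' c') (upTo (suc c))
    inRowUpTo≡count r' r'<L = begin
      inRowUpTo r'
        ≡⟨ ∑-cong (len r') (λ j _ → cong 𝟙 (≤ᵇ-<ᵇ (part β r' + j) c)) ⟩
      ∑ (λ j → 𝟙 (part β r' + j <ᵇ suc c)) (len r')             ≡⟨ cellsBefore-row (suc c) r' ⟩
      cellsBefore (suc c) r'                                    ≡⟨ sym (∑𝟙-interval (part β r') (part α r') (suc c)) ⟩
      ∑ (λ c' → 𝟙 ((part β r' ≤ᵇ c') ∧ (c' <ᵇ part α r'))) (suc c)
        ≡⟨ ∑-cong (suc c) (λ c' _ → cong 𝟙 (sym (inShapeᵇ-row r' c' r'<L))) ⟩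
      ∑ (λ c' → 𝟙 (inShapeᵇ α β r' c')) (suc c)                 ≡⟨ sym (count-upTo _ (suc c)) ⟩
      count (λ c' → inShapeᵇ α β r' c') (upTo (suc c))          ∎

  ls-cells : ∀ {y} → y ∈ cells → ∑ₗ (λ x → 𝟙 ((x ≺ᵇ y) ∧ not (proj₁ y <ᵇ proj₁ x))) cells ≡ ls α β (proj₁ y) (proj₂ y)
  ls-cells {y@(r , c)} y∈ = begin
    ∑ₗ (λ x → 𝟙 ((x ≺ᵇ y) ∧ not (r <ᵇ proj₁ x))) cells
      ≡⟨ ∑ₗ-cong cells (λ x _ → cong 𝟙 (≺-not-above≡weaklySouthWest-other x y)) ⟩
    ∑ₗ other cells                                          ≡⟨ sym (m+n∸m≡n 1 (∑ₗ other cells)) ⟩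
    (1 + ∑ₗ other cells) ∸ 1
      ≡⟨ cong (λ z → (z + ∑ₗ other cells) ∸ 1) (sym (∑ₗ-sameCell cells y Unique-cells y∈)) ⟩
    (∑ₗ (λ x → 𝟙 (sameCellᵇ x y)) cells + ∑ₗ other cells) ∸ 1
      ≡⟨ cong (λ z → (z + ∑ₗ other cells) ∸ 1) (∑ₗ-cong cells (λ x _ → cong 𝟙 (sym (weaklySouthWest-sameCell x y)))) ⟩
    (∑ₗ (λ x → 𝟙 (SW x ∧ sameCellᵇ x y)) cells + ∑ₗ other cells) ∸ 1
      ≡⟨ cong (_∸ 1) (sym (∑ₗ-distrib-+ _ _ cells)) ⟩
    ∑ₗ (λ x → 𝟙 (SW x ∧ sameCellᵇ x y) + 𝟙 (SW x ∧ not (sameCellᵇ x y))) cells ∸ 1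
      ≡⟨ cong (_∸ 1) (∑ₗ-cong cells (λ x _ → sym (𝟙-split (SW x) (sameCellᵇ x y)))) ⟩
    ∑ₗ (𝟙 ∘ SW) cells ∸ 1
      ≡⟨ cong (_∸ 1) (weaklySouthWest-count r c (proj₁ (∈-cells⁻ y∈))) ⟩
    ls α β r c                                              ∎
    where
    open ≡-Reasoning
    SW : ℕ × ℕ → Bool
    SW x = weaklySouthWestᵇ x y
    other : ℕ × ℕ → ℕ
    other x = 𝟙 (SW x ∧ not (sameCellᵇ x y))

  totalLs-cells : totalLs α β ≡ ∑ₗ (λ y → ls α β (proj₁ y) (proj₂ y)) cells
  totalLs-cells = sym (trans (∑ₗ-concat f (map rowCells (upTo L))) (trans (∑ₗ-map (∑ₗ f) rowCells (upTo L))
    (∑ₗ-cong (upTo L) (λ r _ → ∑ₗ-map f (r ,_) (colsOf α β r)))))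
    where
    f : ℕ × ℕ → ℕ
    f y = ls α β (proj₁ y) (proj₂ y)

  -- A pair x ≺ y of cells is an inversion of Scol iff x lies in a higher row; otherwise x is weakly south-west of y,
  -- and these pairs are counted by ls.
  inv-Scol : inv (Scol α β) ≡ n C 2 ∸ totalLs α β
  inv-Scol = sym (trans (cong (_∸ totalLs α β) C2≡) (m+n∸n≡m (inv (Scol α β)) (totalLs α β)))
    where
    open ≡-Reasoning
    above : ℕ × ℕ → ℕ × ℕ → Bool
    above y x = proj₁ y <ᵇ proj₁ x
    inversion nonInversion : ℕ × ℕ → ℕ × ℕ → ℕ
    inversion    y x = 𝟙 ((x ≺ᵇ y) ∧ above y x)
    nonInversion y x = 𝟙 ((x ≺ᵇ y) ∧ not (above y x))
    C2≡ : n C 2 ≡ inv (Scol α β) + totalLs α β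
    C2≡ = begin
      n C 2
        ≡⟨ C2-cells ⟩
      ∑ₗ (λ y → ∑ₗ (λ x → 𝟙 (x ≺ᵇ y)) cells) cells
        ≡⟨ ∑ₗ-cong cells (λ y _ → trans (∑ₗ-cong cells (λ x _ → 𝟙-split (x ≺ᵇ y) (above y x)))
                                         (∑ₗ-distrib-+ _ _ cells)) ⟩
      ∑ₗ (λ y → ∑ₗ (inversion y) cells + ∑ₗ (nonInversion y) cells) cells
        ≡⟨ ∑ₗ-distrib-+ _ _ cells ⟩
      ∑ₗ (λ y → ∑ₗ (inversion y) cells) cells + ∑ₗ (λ y → ∑ₗ (nonInversion y) cells) cells
        ≡⟨ cong₂ _+_ (sym inv-Scol-cells) (trans (∑ₗ-cong cells (λ y y∈ → ls-cells y∈)) (sym totalLs-cells)) ⟩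
      inv (Scol α β) + totalLs α β
        ∎

-- y ↖ x : the cell y lies strictly north-west of x (rows are numbered upwards)
_↖_ : ℕ × ℕ → ℕ × ℕ → Set
(ry , cy) ↖ (rx , cx) = rx < ry × cy < cx

_↖?_ : ∀ y x → Dec (y ↖ x)
(ry , cy) ↖? (rx , cx) = (rx <? ry) ×-dec (cy <? cx)

module SkewPartition (α β : List ℕ) (β⊆α : β ⊆c α) (β-partition : IsPartition β) where

  open Tableaux α β
  open Skew α β β⊆α

  -- The corner (rx , cy) is in the shape because the parts of β weakly decrease.
  entry-weaklySouthWest : ∀ {T} → IsSET′ T → ∀ {ry cy rx cx} → InShape α β ry cy → InShape α β rx cx →
    (ry , cy) ≢ (rx , cx) → ry ≤ rx → cy ≤ cx → entry β T ry cy < entry β T rx cx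
  entry-weaklySouthWest {T} (std , cols) {ry} {cy} {rx} {cx} inY inX y≢x ry≤rx cy≤cx with m≤n⇒m<n∨m≡n ry≤rx
  ... | inj₂ refl = entry-row-< std inY inX (≤∧≢⇒< cy≤cx (λ e → y≢x (cong (ry ,_) e)))
  ... | inj₁ ry<rx with m≤n⇒m<n∨m≡n cy≤cx
  ...   | inj₂ refl = cols cy ry rx ry<rx inY inX
  ...   | inj₁ cy<cx = <-trans (cols cy ry rx ry<rx inY inCorner) (entry-row-< std inCorner inX cy<cx)
    where
    inCorner : InShape α β rx cy
    inCorner = proj₁ inX , ≤-trans (part-antitone β β-partition (<⇒≤ ry<rx)) (proj₁ (proj₂ inY)) ,
               <-trans cy<cx (proj₂ (proj₂ inX))

  NorthWestAscent : Tab → ℕ → Set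
  NorthWestAscent T i = Any (λ x → Any (λ y → entryAt T x ≡ i × entryAt T y ≡ suc i × y ↖ x) cells) cells

  ascent-or-none : ∀ T → (∃ λ i → i < n × (1 ≤ i × NorthWestAscent T i))
                       ⊎ (∀ i → i < n → 1 ≤ i → ¬ NorthWestAscent T i)
  ascent-or-none T with anyUpTo? (λ i → (1 ≤? i) ×-dec ascent? i) n
    where
    ascent? : ∀ i → Dec (NorthWestAscent T i)
    ascent? i = any? (λ x → any? (λ y → (entryAt T x ≟ i) ×-dec ((entryAt T y ≟ suc i) ×-dec (y ↖? x))) cells) cells
  ... | yes a = inj₁ a
  ... | no ¬a = inj₂ (λ i i<n 1≤i a → ¬a (i , i<n , 1≤i , a))

  module _ {T} (set : IsSET′ T) (none : ∀ i → i < n → 1 ≤ i → ¬ NorthWestAscent T i) where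

    private
      std : RowStandard T
      std = proj₁ set

    successor-≺ : ∀ x y → x ∈ cells → y ∈ cells → entryAt T y ≡ suc (entryAt T x) → x ≺ y
    successor-≺ (rx , cx) (ry , cy) x∈ y∈ e with <-cmp cy cx
    ... | tri> _ _ cy>cx = inj₁ cy>cx
    ... | tri< cy<cx _ _ with rx <? ry
    ...   | yes rx<ry = ⊥-elim (none (entryAt T (rx , cx)) (subst (_≤ n) e (proj₂ (entryAt-range std y∈)))
                          (proj₁ (entryAt-range std x∈)) (lose x∈ (lose y∈ (refl , e , rx<ry , cy<cx))))
    ...   | no  rx≮ry = ⊥-elim (<-asym (entry-weaklySouthWest set (∈-cells⁻ y∈) (∈-cells⁻ x∈) y≢x (≮⇒≥ rx≮ry) (<⇒≤ cy<cx))
                                       (subst (entryAt T (rx , cx) <_) (sym e) (n<1+n _)))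
      where
      y≢x : (ry , cy) ≢ (rx , cx)
      y≢x y≡x = 1+n≢n (trans (sym e) (cong (entryAt T) y≡x))
    successor-≺ (rx , cx) (ry , cy) x∈ y∈ e | tri≈ _ refl _ with <-cmp ry rx
    ...   | tri> _ _ ry>rx = inj₂ (refl , ry>rx)
    ...   | tri≈ _ refl _  = ⊥-elim (1+n≢n (sym e))
    ...   | tri< ry<rx _ _ = ⊥-elim (<-asym (entry-weaklySouthWest set (∈-cells⁻ y∈) (∈-cells⁻ x∈)
                                               (λ y≡x → 1+n≢n (trans (sym e) (cong (entryAt T) y≡x))) (<⇒≤ ry<rx) ≤-refl)
                                           (subst (entryAt T (rx , cx) <_) (sym e) (n<1+n _)))

    entryAt-<⇒≺ : ∀ {x y} → x ∈ cells → y ∈ cells → entryAt T x < entryAt T y → x ≺ y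
    entryAt-<⇒≺ {x} {y} x∈ y∈ lt = go (entryAt T y ∸ suc (entryAt T x)) y y∈
      (sym (trans (sym (+-suc (entryAt T y ∸ suc (entryAt T x)) (entryAt T x))) (m∸n+n≡m lt)))
      where
      go : ∀ d y → y ∈ cells → entryAt T y ≡ suc (d + entryAt T x) → x ≺ y
      go zero    y y∈ e = successor-≺ x y x∈ y∈ e
      go (suc d) y y∈ e with entryAt-surjective std {suc (d + entryAt T x)} (s≤s z≤n)
                               (<⇒≤ (<-≤-trans (subst (suc (d + entryAt T x) <_) (sym e) (n<1+n _)) (proj₂ (entryAt-range std y∈))))
      ... | z , z∈ , ez = ≺-trans (go d z z∈ (sym ez)) (successor-≺ z y z∈ y∈ (trans e (cong suc ez)))

    entryAt≡rank : ∀ {x} → x ∈ cells → entryAt T x ≡ rank x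
    entryAt≡rank {x} x∈ = begin
      entryAt T x
        ≡⟨ sym (count-below (entryAt T x) (entryAt-range std x∈)) ⟩
      suc (∑ (λ k → 𝟙 (suc k <ᵇ entryAt T x)) n)
        ≡⟨ cong suc (∑-reindex std (λ k → 𝟙 (k <ᵇ entryAt T x))) ⟩
      suc (∑ₗ (λ y → 𝟙 (entryAt T y <ᵇ entryAt T x)) cells)
        ≡⟨ cong suc (∑ₗ-cong cells (λ y y∈ → cong 𝟙 (same-order y∈))) ⟩
      rank x                                                    ∎
      where
      open ≡-Reasoning
      count-below : ∀ v → 1 ≤ v × v ≤ n → suc (∑ (λ k → 𝟙 (suc k <ᵇ v)) n) ≡ v
      count-below (suc w) (_ , w<n) = cong suc (trans (∑𝟙-< w n) (m≥n⇒m⊓n≡n (≤-trans (n≤1+n w) w<n)))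
      same-order : ∀ {y} → y ∈ cells → (entryAt T y <ᵇ entryAt T x) ≡ (y ≺ᵇ x)
      same-order {y} y∈ with entryAt T y <? entryAt T x
      ... | yes lt  = trans (<ᵇ-true lt) (sym (≺ᵇ-true (entryAt-<⇒≺ y∈ x∈ lt)))
      ... | no  nlt = trans (<ᵇ-false nlt) (sym (≺ᵇ-false y⊀x))
        where
        y⊀x : ¬ y ≺ x
        y⊀x y≺x with <-cmp (entryAt T y) (entryAt T x)
        ... | tri< lt _ _ = nlt lt
        ... | tri≈ _ e _  = ≺-irrefl (subst (_≺ x) (entryAt-injective std y∈ x∈ e) y≺x)
        ... | tri> _ _ gt = ≺-asym y≺x (entryAt-<⇒≺ x∈ y∈ gt)

    no-NorthWestAscent⇒≡Scol : T ≡ Scol α β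
    no-NorthWestAscent⇒≡Scol = tableau-ext T (Scol α β) (proj₁ std) Scol-HasShape
      (λ r c inShape → trans (entryAt≡rank (∈-cells⁺ inShape)) (sym (entry-Scol inShape)))

  -- Swapping i and i+1 puts i+1 below i, so T is one π-step above the swapped tableau.
  undo-ascent : ∀ {T} → IsSET′ T → ∀ i → i < n → 1 ≤ i → NorthWestAscent T i →
                IsSET′ (swapT i T) × suc (inv T) ≡ inv (swapT i T) × Step n (swapT i T) T
  undo-ascent {T} (std , cols) i i<n 1≤i ascent with find ascent
  ... | x , x∈ , ascent′ with find ascent′
  ...   | y , y∈ , (ex , ey , (rx<ry , cy<cx)) = (std′ , cols′) , invs , step
    where
    T′ : Tab
    T′ = swapT i T
    rowOf-i : rowOf i T ≡ proj₁ x
    rowOf-i = trans (cong (λ z → rowOf z T) (sym ex)) (rowOf-entryAt std x∈)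
    rowOf-1+i : rowOf (suc i) T ≡ proj₁ y
    rowOf-1+i = trans (cong (λ z → rowOf z T) (sym ey)) (rowOf-entryAt std y∈)
    std′ : RowStandard T′
    std′ = swapT-RowStandard std i 1≤i i<n (λ e → <-irrefl (trans (sym rowOf-i) (trans (sym e) rowOf-1+i)) rx<ry)
    not-vertical : ∀ c r r' → r < r' → InShape α β r c → InShape α β r' c → ¬ (entry β T r c ≡ i × entry β T r' c ≡ suc i)
    not-vertical c r r' _ inS inS' (e , e') = <⇒≢ cy<cx (trans
      (cong proj₂ (sym (entryAt-injective std (∈-cells⁺ inS') y∈ (trans e' (sym ey)))))
      (cong proj₂ (entryAt-injective std (∈-cells⁺ inS) x∈ (trans e (sym ex)))))
    cols′ : ColumnsIncrease T′
    cols′ = swapT-ColumnsIncrease std cols i 1≤i not-vertical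
    descent : rowOf (suc i) T′ < rowOf i T′
    descent = subst₂ _<_ (sym (trans (rowOf-swapT i (suc i) T) (trans (cong (λ z → rowOf z T) (σ-1+i i)) rowOf-i)))
                         (sym (trans (rowOf-swapT i i T) (trans (cong (λ z → rowOf z T) (σ-i i)) rowOf-1+i))) rx<ry
    invs : suc (inv T) ≡ inv T′
    invs = trans (cong (suc ∘ inv) (sym (swapT-involutive i T))) (inv-swapT T′ i 1≤i i<n descent)
    step : Step n T′ T
    step = i , 1≤i , i<n , subst (λ z → π i T′ ≡ just z) (swapT-involutive i T) (π-swapT i T′ descent)

  Leq-Scol-gap : ∀ k T → n * n ∸ inv T ≡ k → IsSET′ T → Leq α β (Scol α β) T
  Leq-Scol-gap k T gap set with ascent-or-none T
  ... | inj₂ none = subst (λ S → Leq α β S T) (no-NorthWestAscent⇒≡Scol set none) ε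
  ... | inj₁ (i , i<n , 1≤i , ascent) with undo-ascent set i i<n 1≤i ascent | k
  ...   | _ , invs , _ | zero = ⊥-elim (<⇒≱ inv<n*n (m∸n≡0⇒m≤n gap))
    where
    inv<n*n : inv T < n * n
    inv<n*n = subst (_≤ n * n) (sym invs) (inversions≤n*n (λ k → rowOf k (swapT i T)) n)
  ...   | set′ , invs , step | suc k = Leq-Scol-gap k (swapT i T) gap′ set′ ◅◅ (step ◅ ε)
    where
    gap′ : n * n ∸ inv (swapT i T) ≡ k
    gap′ = trans (cong (n * n ∸_) (sym invs)) (trans (sym (pred[m∸n]≡m∸[1+n] (n * n) (inv T))) (cong pred gap))

  Leq-Scol : ∀ {T} → IsSET α β T → Leq α β (Scol α β) T
  Leq-Scol {T} set = Leq-Scol-gap _ T refl (Equivalence.to IsSET⇔RowStandard×ColumnsIncrease set)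

module _ {α β : List ℕ} (β⊆α : β ⊆c α) (β-partition : IsPartition β) where

  open Tableaux α β
  open Skew α β β⊆α
  open SkewPartition α β β⊆α β-partition

  Scol-IsSET : IsSET α β (Scol α β)
  Scol-IsSET = Equivalence.from IsSET⇔RowStandard×ColumnsIncrease Scol-IsSET′

  Scol-minimalSET : IsMinimalSET α β (Scol α β)
  Scol-minimalSET = Scol-IsSET , λ T setT T≤Scol → Leq-antisym T≤Scol (Leq-Scol setT)

  minimalSET≡Scol : ∀ M → IsMinimalSET α β M → M ≡ Scol α β
  minimalSET≡Scol M (setM , minimal) = sym (minimal (Scol α β) Scol-IsSET (Leq-Scol setM))

  SET⇔interval : ∀ T → IsSET α β T ⇔ (IsSIT α β T × Leq α β (Scol α β) T × Leq α β T (Srow α β))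
  SET⇔interval T = mk⇔
    (λ setT → proj₁ setT , Leq-Scol setT , Leq-Srow (IsSIT⇒RowStandard (proj₁ setT)))
    (λ (_ , Scol≤T , _) → Equivalence.from IsSET⇔RowStandard×ColumnsIncrease (Leq-IsSET′ Scol-IsSET′ Scol≤T))

  SET-rank : HasRank α β (size α β C 2 ∸ totalLs α β)
  SET-rank = longest-chain , chain-bound
    where
    longest-chain : ∃ λ Ts → IsChain α β Ts × length Ts ≡ suc (size α β C 2 ∸ totalLs α β)
    longest-chain with sort (inv (Scol α β)) (Scol α β) refl Scol-RowStandard
    ... | Ts , down , length≡ , _ =
      Scol α β ∷ Ts , (s≤s z≤n , Down-IsSET Ts Scol-IsSET′ down , Linked.map Down⇒StrictlyBelow down) ,
      cong suc (trans length≡ inv-Scol)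
    chain-bound : ∀ Ts → IsChain α β Ts → length Ts ≤ suc (size α β C 2 ∸ totalLs α β)
    chain-bound (T ∷ Ts) (_ , setT ∷ _ , chain) =
      s≤s (≤-trans (StrictlyBelow-chain-length T Ts chain) (≤-trans (Leq⇒inv≥ (Leq-Scol setT)) (≤-reflexive inv-Scol)))

corollary15 : (α β : List ℕ) → IsComposition α → IsComposition β → IsPartition β
    → β ⊆c α → Reduced α β
    → (IsMinimalSET α β (Scol α β) × (∀ M → IsMinimalSET α β M → M ≡ Scol α β))
      × (∀ T → IsSET α β T ⇔ (IsSIT α β T × Leq α β (Scol α β) T × Leq α β T (Srow α β)))
      × HasRank α β ((size α β C 2) ∸ totalLs α β)
corollary15 α β _ _ β-partition β⊆α _ =
  (Scol-minimalSET β⊆α β-partition , minimalSET≡Scol β⊆α β-partition) ,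
  SET⇔interval β⊆α β-partition ,
  SET-rank β⊆α β-partition
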